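{- Let $A\in\mathcal C_4(G_n)$ (normalized, poles coloured 1 and 2) with $d(A)=k>1$. Assume that $\xi_1,\xi_2,\dots,\xi_k$ is a sequence of $k$ consecutive components of $A(3,4)$. Then there exists a (normalized) colouring $B_1\in\mathcal C_4(G_n)$ with $B_1\sim A$ such that $B_1(3,4)$ has $k$ consecutive components $\sigma_1,\dots,\sigma_k$ satisfying: (1) $|\sigma_1|=2$; (2) $|\sigma_2|=|\xi_1|+|\xi_2|-2$; (3) $\sigma_i=\xi_i$ for $i>2$; (4) $\sigma_1$ is the first edge of $\xi_1$.
   Context: Fix $n\ge5$. $G_n$ is a simple plane triangulation having two non-adjacent vertices $a,b$ of degree $n$ (the poles) and $2n$ vertices of degree $5$. $N_a,N_b$ are the cycles induced by the neighbours of $a$ and $b$, each oriented clockwise. An edge is of type 1 if one end lies on $N_a$ and the other on $N_b$. $\mathcal C_4(G_n)$ is the set of 4-colourings $V(G_n)\to\{1,2,3,4\}$; $A(i,j)$ is the subgraph induced by vertices coloured $i$ or $j$; its components are Kempe chains; a Kempe change swaps $i,j$ on one chain; $A\sim B$ means one is obtained from the other by finitely many Kempe changes. Colourings whose poles have different colours are normalized so that the poles receive colours 1 and 2; $d(A)$ is the number of type-1 edges in $A(1,2)$. For such $A$ with $d(A)\ge1$, the components of $A(3,4)$ are paths in the annulus between $N_a$ and $N_b$; each is traversed clockwise, which determines its first, …, last edge; the components are cyclically ordered clockwise around the annulus, and $\xi_1,\dots,\xi_k$ are consecutive components if they follow one another in this cyclic order. $|\xi|$ denotes the number of vertices of $\xi$.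 -}

module Defs where

open import Data.Nat using (ℕ; zero; suc; _+_; _*_; _∸_; _<_; _≤_; _≤ᵇ_)
open import Data.Bool using (Bool; true; false; if_then_else_; _∧_)
open import Data.Fin using (Fin; toℕ) renaming (zero to fz; suc to fs)
open import Data.List using (List; []; _∷_; map; allFin)
open import Data.Nat.ListAction using (sum)
open import Data.Empty using (⊥)
open import Data.List.Relation.Unary.Linked using (Linked)
open import Data.List.Relation.Unary.Unique.Propositional using (Unique)
open import Data.List.Membership.Propositional using (_∈_)
open import Data.Product using (_×_; Σ; ∃)
open import Data.Sum using (_⊎_)
open import Relation.Nullary using (¬_)
open import Relation.Binary.PropositionalEquality using (_≡_; _≢_)
open import Relation.Binary.Construct.Closure.ReflexiveTransitive using (Star)

-- Vertices: the two poles a (poleA) and b (poleB), the neighbours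
-- u_i = inner i of a (the cycle N_a) and the neighbours v_i = outer i
-- of b (the cycle N_b), i ∈ Z_n.
-- Every u_i, v_i has degree 5, the poles degree n; this is (up to
-- isomorphism) the unique plane triangulation with the data of G_n.

data Vtx (n : ℕ) : Set where
  poleA poleB : Vtx n
  inner outer : Fin n → Vtx n

-- cyclic successor i ↦ i+1 (mod n)
rot : ∀ {m} → Fin (suc m) → Fin (suc m)
rot-step : ∀ {m} → Fin (suc m) → Fin (suc (suc m))
rot {zero} fz = fz
rot {suc m} fz = fs fz
rot {suc m} (fs i) = rot-step (rot {m} i)
rot-step fz = fz
rot-step (fs j) = fs (fs j)

next : ∀ {n} → Fin n → Fin n
next {suc m} i = rot {m} i

-- clockwise-oriented edges of the annulus between N_a and N_b
-- (orientation: increasing index = clockwise on both N_a and N_b)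
data CwStep {n : ℕ} : Vtx n → Vtx n → Set where
  uu : ∀ i → CwStep (inner i) (inner (next i))
  vv : ∀ i → CwStep (outer i) (outer (next i))
  vu : ∀ i → CwStep (outer i) (inner i)
  uv : ∀ i → CwStep (inner i) (outer (next i))

data Edge {n : ℕ} : Vtx n → Vtx n → Set where
  spoke-a : ∀ i → Edge poleA (inner i)
  spoke-b : ∀ i → Edge poleB (outer i)
  annulus : ∀ {x y} → CwStep x y → Edge x y

Adj : ∀ {n} → Vtx n → Vtx n → Set
Adj x y = Edge x y ⊎ Edge y x

data Colour : Set where
  c₁ c₂ c₃ c₄ : Colour

Colouring : ℕ → Set
Colouring n = Vtx n → Colour

Proper : ∀ {n} → Colouring n → Set
Proper {n} A = ∀ {x y : Vtx n} → Adj x y → A x ≢ A y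

Normalized : ∀ {n} → Colouring n → Set
Normalized A = A poleA ≡ c₁ × A poleB ≡ c₂

InPair : Colour → Colour → Colour → Set
InPair i j c = c ≡ i ⊎ c ≡ j

KEdge : ∀ {n} → Colouring n → Colour → Colour → Vtx n → Vtx n → Set
KEdge A i j x y = Adj x y × InPair i j (A x) × InPair i j (A y)

InChain : ∀ {n} → Colouring n → Colour → Colour → Vtx n → Vtx n → Set
InChain A i j x y = InPair i j (A x) × Star (KEdge A i j) x y

swap : Colour → Colour → Colour → Colour
swap i j c = if eqC c i then j else (if eqC c j then i else c)
  where
  eqC : Colour → Colour → Bool
  eqC c₁ c₁ = true
  eqC c₂ c₂ = true
  eqC c₃ c₃ = true
  eqC c₄ c₄ = true
  eqC _ _ = false

KempeChange : ∀ {n} → Colouring n → Colouring n → Set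
KempeChange {n} A B =
  Σ Colour λ i → Σ Colour λ j → Σ (Vtx n) λ x →
    InPair i j (A x) ×
    (∀ y → (InChain A i j x y → B y ≡ swap i j (A y))
         × (¬ InChain A i j x y → B y ≡ A y))

KempeEquiv : ∀ {n} → Colouring n → Colouring n → Set
KempeEquiv = Star KempeChange

-- d(A): number of type-1 edges (v_i u_i and u_i v_{i+1}) in A(1,2)

isOneTwo : Colour → Bool
isOneTwo c₁ = true
isOneTwo c₂ = true
isOneTwo _ = false

b2n : Bool → ℕ
b2n true = 1
b2n false = 0

d : ∀ {n} → Colouring n → ℕ
d {n} A = sum (map f (allFin n))
  where
  f : Fin n → ℕ
  f i = b2n (isOneTwo (A (outer i)) ∧ isOneTwo (A (inner i)))
      + b2n (isOneTwo (A (inner i)) ∧ isOneTwo (A (outer (next i))))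

-- Components of A(3,4), represented by their clockwise traversal:
-- the list of their vertices in the order in which the path is
-- traversed clockwise (consecutive vertices joined by a clockwise edge).

ComponentPath : ∀ {n} → Colouring n → List (Vtx n) → Set
ComponentPath A [] = ⊥
ComponentPath A (x ∷ xs) =
  Linked CwStep (x ∷ xs) × Unique (x ∷ xs) ×
  (∀ y → (y ∈ x ∷ xs → InChain A c₃ c₄ x y) × (InChain A c₃ c₄ x y → y ∈ x ∷ xs))

firstV : ∀ {n} → List (Vtx n) → Vtx n
firstV [] = poleA
firstV (x ∷ _) = x

lastV : ∀ {n} → List (Vtx n) → Vtx n
lastV [] = poleA
lastV (x ∷ []) = x
lastV (_ ∷ y ∷ ys) = lastV (y ∷ ys)

-- angular position around the annulus: v_i ↦ 2i, u_i ↦ 2i+1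
-- (clockwise edges increase the position by 1 or 2 mod 2n)
pos : ∀ {n} → Vtx n → ℕ
pos poleA = 0
pos poleB = 0
pos (outer i) = 2 * toℕ i
pos (inner i) = suc (2 * toℕ i)

cw : ℕ → ℕ → ℕ → ℕ
cw n p q = if p ≤ᵇ q then q ∸ p else (q + 2 * n) ∸ p

-- η is the component immediately following ξ in the clockwise cyclic
-- order: η starts strictly clockwise after the end of ξ and no vertex
-- of A(3,4) lies strictly between the last vertex of ξ and the first
-- vertex of η.
Next : ∀ {n} → Colouring n → List (Vtx n) → List (Vtx n) → Set
Next {n} A ξ η =
  0 < cw n (pos (lastV ξ)) (pos (firstV η)) ×
  (∀ z → InPair c₃ c₄ (A z) →
     ¬ (0 < cw n (pos (lastV ξ)) (pos z) ×
        cw n (pos (lastV ξ)) (pos z) < cw n (pos (lastV ξ)) (pos (firstV η))))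

Consecutive : ∀ {n} → Colouring n → ℕ → (ℕ → List (Vtx n)) → Set
Consecutive A k ξ =
  (∀ i → 1 ≤ i → i ≤ k → ComponentPath A (ξ i)) ×
  (∀ i → 1 ≤ i → i < k → Next A (ξ i) (ξ (suc i)))

-- Walk the annulus as v₀ u₀ v₁ u₁ …, each vertex adjacent to the two before and the
-- two after it.  A vertex coloured 1 or 2 gets the colour its pole lacks, so no two
-- such vertices are two steps apart, and no three consecutive vertices are coloured
-- 3, 4.  Hence the components of A(3,4) are arcs with steps 1, 2 separated by gaps of
-- one or two vertices, each gap holds at most one type-1 edge of A(1,2) and the arcs
-- none; so k = d(A) consecutive components never return to ξ₁ and are distinct.
-- If |ξ₁| > 2, then ξ₁ ends r r′ with a two-step before r, and ξ₂ starts at s three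
-- steps after r′.  After swapping 3, 4 on ξ₂ if needed so that s and r differ, the
-- Kempe chain of r in A(c(z), c(r)), z the vertex after r′, is {r, z}.  Swapping it
-- turns ξ₁ into ξ₁ minus r r′ and ξ₂ into r′ z ξ₂; repeat until ξ₁ is its first edge.
module Submission where

open import Defs
open import Data.Nat
open import Data.Nat.Properties
open import Data.Nat.DivMod
open import Data.Product using (Σ; _×_; _,_; proj₁; proj₂)
open import Data.Sum using (_⊎_; inj₁; inj₂; [_,_])
open import Data.Empty using (⊥; ⊥-elim)
open import Data.Bool using (true; false; T; _∧_)
open import Data.Unit using (tt)
open import Data.Fin using (Fin; toℕ) renaming (zero to fzero; suc to fsuc)
import Data.Fin.Properties as Fin
open import Data.List using (List; []; _∷_; _++_; length; take; tabulate)
open import Data.List.Properties using (map-tabulate; length-++)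
open import Data.Nat.ListAction using (sum)
open import Data.List.Membership.Propositional using (_∈_; _∉_)
open import Data.List.Membership.Propositional.Properties using (∈-++⁺ˡ; ∈-++⁺ʳ; ∈-++⁻)
open import Data.List.Relation.Unary.Any using (here; there)
open import Data.List.Relation.Unary.Linked using (Linked; []; [-]; _∷_)
open import Data.List.Relation.Unary.Unique.Propositional using (Unique)
open import Data.List.Relation.Unary.AllPairs using ([]; _∷_)
import Data.List.Relation.Unary.All as All
import Data.List.Relation.Unary.All.Properties as All
open import Relation.Binary.Construct.Closure.ReflexiveTransitive using (Star; ε; _◅_; _◅◅_)
open import Relation.Nullary using (¬_; Dec; yes; no)
open import Relation.Nullary.Decidable.Core using (¬¬-excluded-middle)
open import Relation.Binary.PropositionalEquality hiding ([_])
open import Function using (_∘_; id)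

Is12 Is34 : Colour → Set
Is12 = InPair c₁ c₂
Is34 = InPair c₃ c₄

is12⊎is34 : ∀ c → Is12 c ⊎ Is34 c
is12⊎is34 c₁ = inj₁ (inj₁ refl)
is12⊎is34 c₂ = inj₁ (inj₂ refl)
is12⊎is34 c₃ = inj₂ (inj₁ refl)
is12⊎is34 c₄ = inj₂ (inj₂ refl)

is12⇒¬is34 : ∀ {c} → Is12 c → ¬ Is34 c
is12⇒¬is34 (inj₁ refl) (inj₁ ())
is12⇒¬is34 (inj₁ refl) (inj₂ ())
is12⇒¬is34 (inj₂ refl) (inj₁ ())
is12⇒¬is34 (inj₂ refl) (inj₂ ())

swap-first : ∀ i j → swap i j i ≡ j
swap-first c₁ j = refl
swap-first c₂ j = refl
swap-first c₃ j = refl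
swap-first c₄ j = refl

swap-second : ∀ i j → swap i j j ≡ i
swap-second c₁ c₁ = refl
swap-second c₁ c₂ = refl
swap-second c₁ c₃ = refl
swap-second c₁ c₄ = refl
swap-second c₂ c₁ = refl
swap-second c₂ c₂ = refl
swap-second c₂ c₃ = refl
swap-second c₂ c₄ = refl
swap-second c₃ c₁ = refl
swap-second c₃ c₂ = refl
swap-second c₃ c₃ = refl
swap-second c₃ c₄ = refl
swap-second c₄ c₁ = refl
swap-second c₄ c₂ = refl
swap-second c₄ c₃ = refl
swap-second c₄ c₄ = refl

swap-inPair : ∀ i j {c} → InPair i j c → InPair i j (swap i j c)
swap-inPair i j (inj₁ refl) = inj₂ (swap-first i j)
swap-inPair i j (inj₂ refl) = inj₁ (swap-second i j)

swap-involutive : ∀ i j {c} → InPair i j c → swap i j (swap i j c) ≡ c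
swap-involutive i j (inj₁ refl) = trans (cong (swap i j) (swap-first i j)) (swap-second i j)
swap-involutive i j (inj₂ refl) = trans (cong (swap i j) (swap-second i j)) (swap-first i j)

swap-injective : ∀ i j {a b} → InPair i j a → InPair i j b → swap i j a ≡ swap i j b → a ≡ b
swap-injective i j {a} {b} pa pb e = begin
  a                       ≡⟨ swap-involutive i j pa ⟨
  swap i j (swap i j a)   ≡⟨ cong (swap i j) e ⟩
  swap i j (swap i j b)   ≡⟨ swap-involutive i j pb ⟩
  b                       ∎
  where open ≡-Reasoning

swap-34-changes : ∀ {c} → Is34 c → swap c₃ c₄ c ≢ c
swap-34-changes (inj₁ refl) ()
swap-34-changes (inj₂ refl) ()

star-preserves : ∀ {X : Set} {R : X → X → Set} (P : X → Set) →
  (∀ {u v} → P u → R u v → P v) → ∀ {x y} → P x → Star R x y → P y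
star-preserves P step px ε = px
star-preserves P step px (r ◅ rs) = star-preserves P step (step px r) rs

unique-++⁻ˡ : ∀ {X : Set} (xs : List X) {ys} → Unique (xs ++ ys) → Unique xs
unique-++⁻ˡ [] _ = []
unique-++⁻ˡ (x ∷ xs) (x∉ ∷ un) = All.++⁻ˡ xs x∉ ∷ unique-++⁻ˡ xs un

unique-++-disjoint : ∀ {X : Set} (xs : List X) {ys y} → Unique (xs ++ ys) → y ∈ xs → y ∉ ys
unique-++-disjoint (x ∷ xs) (x∉ ∷ _) (here refl) y∈ys = All.lookup (All.++⁻ʳ xs x∉) y∈ys refl
unique-++-disjoint (x ∷ xs) (_ ∷ un) (there y∈xs) = unique-++-disjoint xs un y∈xs

linked-++⁻ˡ : ∀ {X : Set} {R : X → X → Set} (xs : List X) {ys} → Linked R (xs ++ ys) → Linked R xs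
linked-++⁻ˡ [] _ = []
linked-++⁻ˡ (x ∷ []) _ = [-]
linked-++⁻ˡ (x ∷ y ∷ xs) (xRy ∷ lk) = xRy ∷ linked-++⁻ˡ (y ∷ xs) lk

module _ {n : ℕ} where

  inChain-inPair : ∀ {A : Colouring n} {i j x y} → InChain A i j x y → InPair i j (A y)
  inChain-inPair {A} {i} {j} (ax , path) =
    star-preserves (λ w → InPair i j (A w)) (λ _ e → proj₂ (proj₂ e)) ax path

  adj-sym : ∀ {x y : Vtx n} → Adj x y → Adj y x
  adj-sym (inj₁ e) = inj₂ e
  adj-sym (inj₂ e) = inj₁ e

  kempeChange⇒proper : ∀ {A B : Colouring n} → Proper A → KempeChange A B → Proper B
  kempeChange⇒proper {A} {B} properA (i , j , x , ax , recolour) {u} {v} u~v Bu≡Bv =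
    ¬¬-excluded-middle λ u? → ¬¬-excluded-middle λ v? → cases u? v? u~v Bu≡Bv
    where
    inside : ∀ {y} → InChain A i j x y → B y ≡ swap i j (A y)
    inside = proj₁ (recolour _)
    outside : ∀ {y} → ¬ InChain A i j x y → B y ≡ A y
    outside = proj₂ (recolour _)
    -- a 2-coloured edge leaving the chain would extend it
    border : ∀ {u v} → Adj u v → InChain A i j x u → ¬ InChain A i j x v → B u ≢ B v
    border {u} {v} u~v u∈ v∉ Bu≡Bv = v∉ (ax , proj₂ u∈ ◅◅ ((u~v , inChain-inPair u∈ , Av) ◅ ε))
      where
      Av : InPair i j (A v)
      Av = subst (InPair i j) (trans (sym (inside u∈)) (trans Bu≡Bv (outside v∉)))
                 (swap-inPair i j (inChain-inPair u∈))
    cases : ∀ {u v} → Dec (InChain A i j x u) → Dec (InChain A i j x v) → Adj u v → B u ≢ B v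
    cases (yes u∈) (yes v∈) u~v e = properA u~v (swap-injective i j (inChain-inPair u∈) (inChain-inPair v∈)
                                     (trans (sym (inside u∈)) (trans e (inside v∈))))
    cases (no u∉) (no v∉) u~v e = properA u~v (trans (sym (outside u∉)) (trans e (outside v∉)))
    cases (yes u∈) (no v∉) u~v e = border u~v u∈ v∉ e
    cases (no u∉) (yes v∈) u~v e = border (adj-sym u~v) v∈ u∉ (sym e)

_≟V_ : ∀ {n} → (x y : Vtx n) → Dec (x ≡ y)
poleA ≟V poleA = yes refl
poleA ≟V poleB = no λ ()
poleA ≟V inner _ = no λ ()
poleA ≟V outer _ = no λ ()
poleB ≟V poleA = no λ ()
poleB ≟V poleB = yes refl
poleB ≟V inner _ = no λ ()
poleB ≟V outer _ = no λ ()
inner _ ≟V poleA = no λ ()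
inner _ ≟V poleB = no λ ()
inner i ≟V inner j with i Fin.≟ j
... | yes refl = yes refl
... | no i≢j = no λ { refl → i≢j refl }
inner _ ≟V outer _ = no λ ()
outer _ ≟V poleA = no λ ()
outer _ ≟V poleB = no λ ()
outer _ ≟V inner _ = no λ ()
outer i ≟V outer j with i Fin.≟ j
... | yes refl = yes refl
... | no i≢j = no λ { refl → i≢j refl }

module _ {n : ℕ} where
  open import Data.List.Membership.DecPropositional (_≟V_ {n}) using (_∈?_)

  swapOn : Colour → Colour → List (Vtx n) → Colouring n → Colouring n
  swapOn i j L A y with y ∈? L
  ... | yes _ = swap i j (A y)
  ... | no _ = A y

  swapOn-∈ : ∀ {i j L A y} → y ∈ L → swapOn i j L A y ≡ swap i j (A y)
  swapOn-∈ {L = L} {y = y} y∈ with y ∈? L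
  ... | yes _ = refl
  ... | no y∉ = ⊥-elim (y∉ y∈)

  swapOn-∉ : ∀ {i j L A y} → y ∉ L → swapOn i j L A y ≡ A y
  swapOn-∉ {L = L} {y = y} y∉ with y ∈? L
  ... | yes y∈ = ⊥-elim (y∉ y∈)
  ... | no _ = refl

  kempeChange-swapOn : ∀ {A : Colouring n} {i j x L} → InPair i j (A x) →
    (∀ {y} → InChain A i j x y → y ∈ L) → (∀ {y} → y ∈ L → InChain A i j x y) →
    KempeChange A (swapOn i j L A)
  kempeChange-swapOn ax chain⊆L L⊆chain =
    _ , _ , _ , ax , λ y → (λ y∈ → swapOn-∈ (chain⊆L y∈)) , (λ y∉ → swapOn-∉ (λ y∈L → y∉ (L⊆chain y∈L)))

  swapOn-normalized : ∀ {A : Colouring n} {i j L} → poleA ∉ L → poleB ∉ L →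
    Normalized A → Normalized (swapOn i j L A)
  swapOn-normalized a∉ b∉ (Aa , Ab) = trans (swapOn-∉ a∉) Aa , trans (swapOn-∉ b∉) Ab

module _ {n : ℕ} where

  All34 : Colouring n → List (Vtx n) → Set
  All34 A L = ∀ {y} → y ∈ L → Is34 (A y)

  Closed34 : Colouring n → List (Vtx n) → Set
  Closed34 A L = ∀ {u v} → u ∈ L → KEdge A c₃ c₄ u v → v ∈ L

  lastV-∷-∈ : ∀ (x : Vtx n) xs → lastV (x ∷ xs) ∈ x ∷ xs
  lastV-∷-∈ x [] = here refl
  lastV-∷-∈ x (y ∷ ys) = there (lastV-∷-∈ y ys)

  linked⇒chain : ∀ {A : Colouring n} {h} t → Linked CwStep (h ∷ t) → All34 A (h ∷ t) →
    ∀ {y} → y ∈ h ∷ t → Star (KEdge A c₃ c₄) h y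
  linked⇒chain t lk all34 (here refl) = ε
  linked⇒chain (h′ ∷ t) (st ∷ lk) all34 (there y∈) =
    (inj₁ (annulus st) , all34 (here refl) , all34 (there (here refl))) ◅
    linked⇒chain t lk (λ y∈′ → all34 (there y∈′)) y∈

  componentPath-intro : ∀ {A : Colouring n} {h} t → Linked CwStep (h ∷ t) → Unique (h ∷ t) →
    All34 A (h ∷ t) → Closed34 A (h ∷ t) → ComponentPath A (h ∷ t)
  componentPath-intro t lk un all34 closed = lk , un , λ y →
    (λ y∈ → all34 (here refl) , linked⇒chain t lk all34 y∈) ,
    (λ chain → star-preserves (_∈ _) closed (here refl) (proj₂ chain))

  module _ {A : Colouring n} where

    componentPath-all34 : ∀ {L} → ComponentPath A L → All34 A L
    componentPath-all34 {_ ∷ _} (_ , _ , chain) y∈ = inChain-inPair (proj₁ (chain _) y∈)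

    componentPath-closed : ∀ {L} → ComponentPath A L → Closed34 A L
    componentPath-closed {_ ∷ _} (_ , _ , chain) u∈ e with proj₁ (chain _) u∈
    ... | h34 , path = proj₂ (chain _) (h34 , path ◅◅ (e ◅ ε))

    componentPath-linked : ∀ {L} → ComponentPath A L → Linked CwStep L
    componentPath-linked {_ ∷ _} = proj₁

    componentPath-unique : ∀ {L} → ComponentPath A L → Unique L
    componentPath-unique {_ ∷ _} = proj₁ ∘ proj₂

    componentPath-chain⊆ : ∀ {L y} → ComponentPath A L → InChain A c₃ c₄ (firstV L) y → y ∈ L
    componentPath-chain⊆ {_ ∷ _} (_ , _ , chain) = proj₂ (chain _)

    componentPath-⊆chain : ∀ {L y} → ComponentPath A L → y ∈ L → InChain A c₃ c₄ (firstV L) y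
    componentPath-⊆chain {_ ∷ _} (_ , _ , chain) = proj₁ (chain _)

    firstV-∈ : ∀ {L} → ComponentPath A L → firstV L ∈ L
    firstV-∈ {_ ∷ _} _ = here refl

    lastV-∈ : ∀ {L} → ComponentPath A L → lastV L ∈ L
    lastV-∈ {x ∷ xs} _ = lastV-∷-∈ x xs

  split-last-two : ∀ {x y w rest} → Linked CwStep (x ∷ y ∷ w ∷ rest) →
    Σ (Vtx n) λ h → Σ (List (Vtx n)) λ t → Σ (Vtx n) λ a → Σ (Vtx n) λ b →
      x ∷ y ∷ w ∷ rest ≡ (h ∷ t) ++ a ∷ b ∷ [] × CwStep (lastV (h ∷ t)) a × CwStep a b
  split-last-two {x} {y} {w} {[]} (x→y ∷ y→w ∷ [-]) = x , [] , y , w , refl , x→y , y→w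
  split-last-two {x} {rest = _ ∷ _} (_ ∷ lk) with split-last-two lk
  ... | h , t , a , b , eq , h→a , a→b = x , h ∷ t , a , b , cong (x ∷_) eq , h→a , a→b

  lastV-++-two : ∀ (xs : List (Vtx n)) {a b} → lastV (xs ++ a ∷ b ∷ []) ≡ b
  lastV-++-two [] = refl
  lastV-++-two (x ∷ []) = refl
  lastV-++-two (x ∷ y ∷ xs) = lastV-++-two (y ∷ xs)

  SameSupport : Colouring n → Colouring n → Set
  SameSupport A B = ∀ y → (Is34 (A y) → Is34 (B y)) × (Is34 (B y) → Is34 (A y))

  componentPath-transfer : ∀ {A B} → SameSupport A B → ∀ {L} → ComponentPath A L → ComponentPath B L
  componentPath-transfer same {_ ∷ t} c =
    componentPath-intro t (componentPath-linked c) (componentPath-unique c)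
      (λ y∈ → proj₁ (same _) (componentPath-all34 c y∈))
      (λ u∈ (u~v , Bu , Bv) → componentPath-closed c u∈
        (u~v , proj₂ (same _) Bu , proj₂ (same _) Bv))

  consecutive-transfer : ∀ {A B} → SameSupport A B → ∀ {k ξ} → Consecutive A k ξ → Consecutive B k ξ
  consecutive-transfer same (comps , nexts) =
    (λ i 1≤i i≤k → componentPath-transfer same (comps i 1≤i i≤k)) ,
    (λ i 1≤i i<k → let (gap , empty) = nexts i 1≤i i<k in gap , λ z Bz → empty z (proj₂ (same z) Bz))

rot-step-zero : ∀ {m} (j : Fin (suc m)) → toℕ j ≡ 0 → toℕ (rot-step j) ≡ 0
rot-step-zero fzero _ = refl

rot-step-suc : ∀ {m} (j : Fin (suc m)) {t} → toℕ j ≡ suc t → toℕ (rot-step j) ≡ suc (suc t)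
rot-step-suc (fsuc j) e = cong suc e

rot-cases : ∀ {m} (i : Fin (suc m)) →
  (toℕ i < m × toℕ (rot i) ≡ suc (toℕ i)) ⊎ (toℕ i ≡ m × toℕ (rot i) ≡ 0)
rot-cases {zero} fzero = inj₂ (refl , refl)
rot-cases {suc m} fzero = inj₁ (s≤s z≤n , refl)
rot-cases {suc m} (fsuc i) with rot-cases {m} i
... | inj₁ (i<m , e) = inj₁ (s≤s i<m , rot-step-suc (rot i) e)
... | inj₂ (i≡m , e) = inj₂ (cong suc i≡m , rot-step-zero (rot i) e)

-- The annulus of G_(1+m) is walked as v₀ u₀ v₁ u₁ …: the q-th vertex is at q,
-- whose position is q mod 2(1+m), and each vertex is adjacent to the vertices
-- 1 and 2 steps ahead and behind.
module Annulus (m : ℕ) where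

  n N : ℕ
  n = suc m
  N = 2 * n

  instance
    N-nonZero : NonZero N
    N-nonZero = _

  V : Set
  V = Vtx n

  open import Data.List.Membership.DecPropositional (_≟V_ {n}) using (_∈?_)

  data Annular : V → Set where
    is-outer : ∀ i → Annular (outer i)
    is-inner : ∀ i → Annular (inner i)

  step : V → V
  step poleA = poleA
  step poleB = poleB
  step (outer i) = inner i
  step (inner i) = outer (next i)

  at : ℕ → V
  at zero = outer fzero
  at (suc q) = step (at q)

  step-annular : ∀ {x} → Annular x → Annular (step x)
  step-annular (is-outer i) = is-inner i
  step-annular (is-inner i) = is-outer (next i)

  at-annular : ∀ q → Annular (at q)
  at-annular zero = is-outer fzero
  at-annular (suc q) = step-annular (at-annular q)

  2+2i≤N : ∀ (i : Fin n) → suc (suc (2 * toℕ i)) ≤ N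
  2+2i≤N i = subst (_≤ N) (*-suc 2 (toℕ i)) (*-monoʳ-≤ 2 (Fin.toℕ<n i))

  pos<N : ∀ {x} → Annular x → pos x < N
  pos<N (is-outer i) = <-trans (n<1+n _) (2+2i≤N i)
  pos<N (is-inner i) = 2+2i≤N i

  pos-step : ∀ {x} → Annular x → pos (step x) ≡ suc (pos x) % N
  pos-step (is-outer i) = sym (m<n⇒m%n≡m (2+2i≤N i))
  pos-step (is-inner i) with rot-cases i
  ... | inj₁ (_ , e) = begin
    2 * toℕ (next i)          ≡⟨ cong (2 *_) e ⟩
    2 * suc (toℕ i)           ≡⟨ *-suc 2 (toℕ i) ⟩
    suc (suc (2 * toℕ i))     ≡⟨ m<n⇒m%n≡m 2+2i<N ⟨
    suc (suc (2 * toℕ i)) % N ∎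
    where
    open ≡-Reasoning
    2+2i<N : suc (suc (2 * toℕ i)) < N
    2+2i<N = subst (_< N) (trans (cong (2 *_) e) (*-suc 2 (toℕ i))) (pos<N (is-outer (next i)))
  ... | inj₂ (i≡m , e) = begin
    2 * toℕ (next i)          ≡⟨ cong (2 *_) e ⟩
    0                         ≡⟨ n%n≡0 N ⟨
    N % N                     ≡⟨ cong (λ t → 2 * suc t % N) i≡m ⟨
    2 * suc (toℕ i) % N       ≡⟨ cong (_% N) (*-suc 2 (toℕ i)) ⟩
    suc (suc (2 * toℕ i)) % N ∎
    where open ≡-Reasoning

  1<N : 1 < N
  1<N = *-monoʳ-≤ 2 (s≤s z≤n)

  pos-at : ∀ q → pos (at q) ≡ q % N
  pos-at zero = refl
  pos-at (suc q) = begin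
    pos (step (at q))         ≡⟨ pos-step (at-annular q) ⟩
    suc (pos (at q)) % N      ≡⟨ cong (λ t → suc t % N) (pos-at q) ⟩
    (1 + q % N) % N           ≡⟨ cong (λ t → (t + q % N) % N) (m<n⇒m%n≡m 1<N) ⟨
    (1 % N + q % N) % N       ≡⟨ %-distribˡ-+ 1 q N ⟨
    suc q % N                 ∎
    where open ≡-Reasoning

  pos-injective : ∀ {x y} → Annular x → Annular y → pos x ≡ pos y → x ≡ y
  pos-injective (is-outer i) (is-outer j) e = cong outer (Fin.toℕ-injective (*-cancelˡ-≡ _ _ 2 e))
  pos-injective (is-outer i) (is-inner j) e = ⊥-elim (even≢odd (toℕ i) (toℕ j) e)
  pos-injective (is-inner i) (is-outer j) e = ⊥-elim (even≢odd (toℕ j) (toℕ i) (sym e))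
  pos-injective (is-inner i) (is-inner j) e = cong inner (Fin.toℕ-injective (*-cancelˡ-≡ _ _ 2 (suc-injective e)))

  at-pos : ∀ {x} → Annular x → x ≡ at (pos x)
  at-pos {x} ax = pos-injective ax (at-annular (pos x))
    (sym (trans (pos-at (pos x)) (m<n⇒m%n≡m (pos<N ax))))

  at-cong : ∀ {a b} → a % N ≡ b % N → at a ≡ at b
  at-cong {a} {b} e = pos-injective (at-annular a) (at-annular b) (trans (pos-at a) (trans e (sym (pos-at b))))

  at-injective : ∀ {a b} → at a ≡ at b → a % N ≡ b % N
  at-injective {a} {b} e = trans (sym (pos-at a)) (trans (cong pos e) (pos-at b))

  at-periodic : ∀ a k → at (a + k * N) ≡ at a
  at-periodic a k = at-cong {a + k * N} {a} ([m+kn]%n≡m%n a k N)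

  at-N+ : ∀ a → at (N + a) ≡ at a
  at-N+ a = at-cong {N + a} {a} (trans (cong (_% N) (+-comm N a)) ([m+n]%n≡m%n a N))

  at-shiftˡ : ∀ {a b} c → at a ≡ at b → at (c + a) ≡ at (c + b)
  at-shiftˡ zero e = e
  at-shiftˡ (suc c) e = cong step (at-shiftˡ c e)

  at-shiftʳ : ∀ {a b} c → at a ≡ at b → at (a + c) ≡ at (b + c)
  at-shiftʳ {a} {b} c e = trans (cong at (+-comm a c)) (trans (at-shiftˡ c e) (cong at (+-comm c b)))

  -- adding c(N ∸ 1) undoes a shift by c, up to a multiple of N
  at-cancelˡ : ∀ {a b} c → at (c + a) ≡ at (c + b) → at a ≡ at b
  at-cancelˡ {a} {b} c e = begin
    at a                  ≡⟨ at-periodic a c ⟨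
    at (a + c * N)        ≡⟨ cong at (undo a) ⟩
    at (k + (c + a))      ≡⟨ at-shiftˡ k e ⟩
    at (k + (c + b))      ≡⟨ cong at (undo b) ⟨
    at (b + c * N)        ≡⟨ at-periodic b c ⟩
    at b                  ∎
    where
    open ≡-Reasoning
    k = (N ∸ 1) * c
    undo : ∀ t → t + c * N ≡ k + (c + t)
    undo t = begin
      t + c * N           ≡⟨ +-comm t (c * N) ⟩
      c * N + t           ≡⟨ cong (_+ t) (*-comm c N) ⟩
      N * c + t           ≡⟨ cong (λ u → u * c + t) (m∸n+n≡m {N} {1} (<⇒≤ 1<N)) ⟨
      (N ∸ 1 + 1) * c + t ≡⟨ cong (_+ t) (*-distribʳ-+ c (N ∸ 1) 1) ⟩
      k + 1 * c + t       ≡⟨ cong (λ u → k + u + t) (*-identityˡ c) ⟩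
      k + c + t           ≡⟨ +-assoc k c t ⟩
      k + (c + t)         ∎

  at-distinct : ∀ a {c} → 0 < c → c < N → at a ≢ at (a + c)
  at-distinct a {c} 0<c c<N e = <⇒≢ 0<c (trans (at-injective {0} {c} at0≡atc) (m<n⇒m%n≡m c<N))
    where
    at0≡atc : at 0 ≡ at c
    at0≡atc = at-cancelˡ a (trans (cong at (+-identityʳ a)) e)

  outer≡at : ∀ i → outer i ≡ at (2 * toℕ i)
  outer≡at i = at-pos (is-outer i)

  inner≡at : ∀ i → inner i ≡ at (suc (2 * toℕ i))
  inner≡at i = at-pos (is-inner i)

  cw-≤ : ∀ {p q} → p ≤ q → cw n p q ≡ q ∸ p
  cw-≤ {p} {q} p≤q with p ≤ᵇ q | ≤⇒≤ᵇ p≤q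
  ... | true | _ = refl

  cw-> : ∀ {p q} → q < p → cw n p q ≡ (q + N) ∸ p
  cw-> {p} {q} q<p with p ≤ᵇ q in eq
  ... | true = ⊥-elim (<⇒≱ q<p (≤ᵇ⇒≤ p q (subst T (sym eq) tt)))
  ... | false = refl

  cw<N : ∀ {p q} → p < N → q < N → cw n p q < N
  cw<N {p} {q} p<N q<N with p ≤? q
  ... | yes p≤q = subst (_< N) (sym (cw-≤ p≤q)) (≤-<-trans (m∸n≤m q p) q<N)
  ... | no p≰q = subst (_< N) (sym (cw-> (≰⇒> p≰q))) (begin-strict
    (q + N) ∸ p   <⟨ ∸-monoʳ-< (≰⇒> p≰q) (≤-trans (<⇒≤ p<N) (m≤n+m N q)) ⟩
    (q + N) ∸ q   ≡⟨ m+n∸m≡n q N ⟩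
    N             ∎)
    where open ≤-Reasoning

  %-absorbˡ : ∀ a c → (a + c) % N ≡ (a % N + c) % N
  %-absorbˡ a c = begin
    (a + c) % N                 ≡⟨ %-distribˡ-+ a c N ⟩
    (a % N + c % N) % N         ≡⟨ cong (λ t → (t + c % N) % N) (m%n%n≡m%n a N) ⟨
    (a % N % N + c % N) % N     ≡⟨ %-distribˡ-+ (a % N) c N ⟨
    (a % N + c) % N             ∎
    where open ≡-Reasoning

  cw-at : ∀ a {c} → c < N → cw n (pos (at a)) (pos (at (a + c))) ≡ c
  cw-at a {c} c<N rewrite pos-at a | pos-at (a + c) | %-absorbˡ a c with a % N + c <? N
  ... | yes p+c<N rewrite m<n⇒m%n≡m p+c<N = trans (cw-≤ (m≤m+n (a % N) c)) (m+n∸m≡n (a % N) c)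
  ... | no p+c≮N = trans (cw-> wrapped<p) (trans (cong (_∸ p) unwrap) (m+n∸m≡n p c))
    where
    open ≤-Reasoning
    p = a % N
    N≤p+c : N ≤ p + c
    N≤p+c = ≮⇒≥ p+c≮N
    wrap : (p + c) % N ≡ (p + c) ∸ N
    wrap = trans (sym (m≤n⇒[n∸m]%m≡n%m N≤p+c)) (m<n⇒m%n≡m (begin-strict
      (p + c) ∸ N   <⟨ ∸-monoˡ-< (+-monoʳ-< p c<N) N≤p+c ⟩
      (p + N) ∸ N   ≡⟨ m+n∸n≡m p N ⟩
      p             <⟨ m%n<n a N ⟩
      N             ∎))
    unwrap : (p + c) % N + N ≡ p + c
    unwrap = trans (cong (_+ N) wrap) (m∸n+n≡m N≤p+c)
    wrapped<p : (p + c) % N < p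
    wrapped<p = +-cancelʳ-< N _ _ (begin-strict
      (p + c) % N + N   ≡⟨ unwrap ⟩
      p + c             <⟨ +-monoʳ-< p c<N ⟩
      p + N             ∎)

  at-cw : ∀ a {z} → Annular z → z ≡ at (a + cw n (pos (at a)) (pos z))
  at-cw a {z} az = trans (at-pos az) (at-cong {pos z} {a + cw n p q} (sym (go (p ≤? q))))
    where
    open ≡-Reasoning
    p = pos (at a)
    q = pos z
    shift : ∀ d → (a + d) % N ≡ (p + d) % N
    shift d = trans (%-absorbˡ a d) (cong (λ t → (t + d) % N) (sym (pos-at a)))
    go : Dec (p ≤ q) → (a + cw n p q) % N ≡ q % N
    go (yes p≤q) = begin
      (a + cw n p q) % N    ≡⟨ shift (cw n p q) ⟩
      (p + cw n p q) % N    ≡⟨ cong (λ d → (p + d) % N) (cw-≤ p≤q) ⟩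
      (p + (q ∸ p)) % N     ≡⟨ cong (_% N) (m+[n∸m]≡n p≤q) ⟩
      q % N                 ∎
    go (no p≰q) = begin
      (a + cw n p q) % N    ≡⟨ shift (cw n p q) ⟩
      (p + cw n p q) % N    ≡⟨ cong (λ d → (p + d) % N) (cw-> (≰⇒> p≰q)) ⟩
      (p + (q + N ∸ p)) % N ≡⟨ cong (_% N) (m+[n∸m]≡n (≤-trans (<⇒≤ (pos<N (at-annular a))) (m≤n+m N q))) ⟩
      (q + N) % N           ≡⟨ [m+n]%n≡m%n q N ⟩
      q % N                 ∎

  cwStep-step : ∀ {x y} → CwStep x y → Annular x × (y ≡ step x ⊎ y ≡ step (step x))
  cwStep-step (uu i) = is-inner i , inj₂ refl
  cwStep-step (vv i) = is-outer i , inj₂ refl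
  cwStep-step (vu i) = is-outer i , inj₁ refl
  cwStep-step (uv i) = is-inner i , inj₁ refl

  step-cwStep : ∀ {x} → Annular x → CwStep x (step x)
  step-cwStep (is-outer i) = vu i
  step-cwStep (is-inner i) = uv i

  step²-cwStep : ∀ {x} → Annular x → CwStep x (step (step x))
  step²-cwStep (is-outer i) = vv i
  step²-cwStep (is-inner i) = uu i

  at-adj₁ : ∀ q → Adj (at q) (at (1 + q))
  at-adj₁ q = inj₁ (annulus (step-cwStep (at-annular q)))

  at-adj₂ : ∀ q → Adj (at q) (at (2 + q))
  at-adj₂ q = inj₁ (annulus (step²-cwStep (at-annular q)))

  IsPole : V → Set
  IsPole y = y ≡ poleA ⊎ y ≡ poleB

  annular-¬pole : ∀ {x} → Annular x → ¬ IsPole x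
  annular-¬pole (is-outer i) (inj₁ ())
  annular-¬pole (is-outer i) (inj₂ ())
  annular-¬pole (is-inner i) (inj₁ ())
  annular-¬pole (is-inner i) (inj₂ ())

  data Neighbour (q : ℕ) : V → Set where
    back₂ : Neighbour q (at q)
    back₁ : Neighbour q (at (1 + q))
    ahead₁ : Neighbour q (at (3 + q))
    ahead₂ : Neighbour q (at (4 + q))
    pole : ∀ {p} → IsPole p → Neighbour q p

  adj-cases : ∀ {x y} → Annular x → Adj x y →
    (y ≡ step x ⊎ y ≡ step (step x)) ⊎ (Annular y × (x ≡ step y ⊎ x ≡ step (step y))) ⊎ IsPole y
  adj-cases () (inj₁ (spoke-a i))
  adj-cases () (inj₁ (spoke-b i))
  adj-cases _ (inj₁ (annulus st)) = inj₁ (proj₂ (cwStep-step st))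
  adj-cases _ (inj₂ (spoke-a i)) = inj₂ (inj₂ (inj₁ refl))
  adj-cases _ (inj₂ (spoke-b i)) = inj₂ (inj₂ (inj₂ refl))
  adj-cases _ (inj₂ (annulus st)) = inj₂ (inj₁ (cwStep-step st))

  neighbours : ∀ q {y} → Adj (at (2 + q)) y → Neighbour q y
  neighbours q {y} x~y with adj-cases (at-annular (2 + q)) x~y
  ... | inj₁ (inj₁ refl) = ahead₁
  ... | inj₁ (inj₂ refl) = ahead₂
  ... | inj₂ (inj₂ p) = pole p
  ... | inj₂ (inj₁ (ay , inj₁ e)) = subst (Neighbour q) (sym y≡) back₁
    where
    y≡ : y ≡ at (1 + q)
    y≡ = trans (at-pos ay) (sym (at-cancelˡ {1 + q} {pos y} 1 (trans e (cong step (at-pos ay)))))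
  ... | inj₂ (inj₁ (ay , inj₂ e)) = subst (Neighbour q) (sym y≡) back₂
    where
    y≡ : y ≡ at q
    y≡ = trans (at-pos ay) (sym (at-cancelˡ {q} {pos y} 2 (trans e (cong (step ∘ step) (at-pos ay)))))

  -- the colour of {1, 2} that the pole adjacent to an annular vertex does not use
  forced12 : V → Colour
  forced12 (inner _) = c₂
  forced12 _ = c₁

  forced12-step : ∀ {x} → Annular x → forced12 (step x) ≢ forced12 x
  forced12-step (is-outer i) ()
  forced12-step (is-inner i) ()

  forced12-at₁ : ∀ q → forced12 (at (1 + q)) ≢ forced12 (at q)
  forced12-at₁ q = forced12-step (at-annular q)

  forced12-at₂ : ∀ q → forced12 (at (2 + q)) ≡ forced12 (at q)
  forced12-at₂ q with at q | at-annular q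
  ... | _ | is-outer i = refl
  ... | _ | is-inner i = refl

  -- Arc p L l: L runs along the walk from at p to at (p + l), in steps of 1 or 2
  data Arc : ℕ → List V → ℕ → Set where
    arc-end : ∀ {p x} → x ≡ at p → Arc p (x ∷ []) 0
    arc-1 : ∀ {p x xs l} → x ≡ at p → Arc (1 + p) xs l → Arc p (x ∷ xs) (1 + l)
    arc-2 : ∀ {p x xs l} → x ≡ at p → Arc (2 + p) xs l → Arc p (x ∷ xs) (2 + l)

  linked⇒arc : ∀ {p h} t → h ≡ at p → Linked CwStep (h ∷ t) → Σ ℕ (Arc p (h ∷ t))
  linked⇒arc [] h≡ _ = 0 , arc-end h≡
  linked⇒arc {p} (h′ ∷ t) h≡ (st ∷ lk) with proj₂ (cwStep-step st)
  ... | inj₁ e = let (l , arc) = linked⇒arc t (trans e (cong step h≡)) lk in 1 + l , arc-1 h≡ arc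
  ... | inj₂ e = let (l , arc) = linked⇒arc t (trans e (cong (step ∘ step) h≡)) lk in 2 + l , arc-2 h≡ arc

  arc-firstV : ∀ {p L l} → Arc p L l → firstV L ≡ at p
  arc-firstV (arc-end e) = e
  arc-firstV (arc-1 e _) = e
  arc-firstV (arc-2 e _) = e

  arc-lastV : ∀ {p L l} → Arc p L l → lastV L ≡ at (p + l)
  arc-lastV {p} (arc-end e) = trans e (cong at (sym (+-identityʳ p)))
  arc-lastV {p} (arc-1 {xs = _ ∷ _} {l = l} _ arc) = trans (arc-lastV arc) (cong at (sym (+-suc p l)))
  arc-lastV {p} (arc-2 {xs = _ ∷ _} {l = l} _ arc) =
    trans (arc-lastV arc) (cong at (trans (cong suc (sym (+-suc p l))) (sym (+-suc p (suc l)))))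

  arc-∈ : ∀ {p L l y} → Arc p L l → y ∈ L → Σ ℕ λ j → j ≤ l × y ≡ at (p + j)
  arc-∈ {p} arc (here refl) = 0 , z≤n , trans (arc-firstV arc) (cong at (sym (+-identityʳ p)))
  arc-∈ {p} (arc-1 _ arc) (there y∈) with arc-∈ arc y∈
  ... | j , j≤l , y≡ = suc j , s≤s j≤l , trans y≡ (cong at (sym (+-suc p j)))
  arc-∈ {p} (arc-2 _ arc) (there y∈) with arc-∈ arc y∈
  ... | j , j≤l , y≡ = 2 + j , s≤s (s≤s j≤l) ,
                       trans y≡ (cong at (trans (cong suc (sym (+-suc p j))) (sym (+-suc p (suc j)))))

  Disjoint : ℕ → (ℕ → List V) → Set
  Disjoint k ξ = ∀ i j → 1 ≤ i → i < j → j ≤ k → ∀ {y} → y ∈ ξ i → y ∈ ξ j → ⊥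

  module ProperColouring (A : Colouring n) (proper : Proper A) (normal : Normalized A) where

    is12-forced : ∀ {x} → Annular x → Is12 (A x) → A x ≡ forced12 x
    is12-forced (is-outer i) (inj₁ e) = e
    is12-forced (is-outer i) (inj₂ e) = ⊥-elim (proper (inj₂ (spoke-b i)) (trans e (sym (proj₂ normal))))
    is12-forced (is-inner i) (inj₁ e) = ⊥-elim (proper (inj₂ (spoke-a i)) (trans e (sym (proj₁ normal))))
    is12-forced (is-inner i) (inj₂ e) = e

    pole-is12 : ∀ {p} → IsPole p → Is12 (A p)
    pole-is12 (inj₁ refl) = inj₁ (proj₁ normal)
    pole-is12 (inj₂ refl) = inj₂ (proj₂ normal)

    pole-colour : ∀ {x p} → Adj x p → IsPole p → A p ≢ forced12 x
    pole-colour (inj₂ (spoke-a i)) _ e with () ← trans (sym (proj₁ normal)) e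
    pole-colour (inj₂ (spoke-b i)) _ e with () ← trans (sym (proj₂ normal)) e
    pole-colour (inj₁ (annulus ())) (inj₁ refl)
    pole-colour (inj₁ (annulus ())) (inj₂ refl)
    pole-colour (inj₂ (annulus ())) (inj₁ refl)
    pole-colour (inj₂ (annulus ())) (inj₂ refl)

    is34⇒annular : ∀ {y} → Is34 (A y) → Annular y
    is34⇒annular {poleA} a34 = ⊥-elim (is12⇒¬is34 (pole-is12 (inj₁ refl)) a34)
    is34⇒annular {poleB} a34 = ⊥-elim (is12⇒¬is34 (pole-is12 (inj₂ refl)) a34)
    is34⇒annular {inner i} _ = is-inner i
    is34⇒annular {outer i} _ = is-outer i

    is12⇒¬is12-at₂ : ∀ q → Is12 (A (at q)) → ¬ Is12 (A (at (2 + q)))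
    is12⇒¬is12-at₂ q a12 b12 = proper (at-adj₂ q) (begin
      A (at q)                ≡⟨ is12-forced (at-annular q) a12 ⟩
      forced12 (at q)         ≡⟨ forced12-at₂ q ⟨
      forced12 (at (2 + q))   ≡⟨ is12-forced (at-annular (2 + q)) b12 ⟨
      A (at (2 + q))          ∎)
      where open ≡-Reasoning

    -- the three vertices form a triangle
    ¬is34-triple : ∀ q → Is34 (A (at q)) → Is34 (A (at (1 + q))) → ¬ Is34 (A (at (2 + q)))
    ¬is34-triple q a b c = two-colours a b c (proper (at-adj₁ q)) (proper (at-adj₂ q)) (proper (at-adj₁ (1 + q)))
      where
      two-colours : ∀ {x y z} → Is34 x → Is34 y → Is34 z → x ≢ y → x ≢ z → y ≢ z → ⊥
      two-colours (inj₁ refl) (inj₁ refl) _ x≢y _ _ = x≢y refl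
      two-colours (inj₂ refl) (inj₂ refl) _ x≢y _ _ = x≢y refl
      two-colours (inj₁ refl) (inj₂ refl) (inj₁ refl) _ x≢z _ = x≢z refl
      two-colours (inj₁ refl) (inj₂ refl) (inj₂ refl) _ _ y≢z = y≢z refl
      two-colours (inj₂ refl) (inj₁ refl) (inj₁ refl) _ _ y≢z = y≢z refl
      two-colours (inj₂ refl) (inj₁ refl) (inj₂ refl) _ x≢z _ = x≢z refl

    Gap : ℕ → ℕ → Set
    Gap a δ = 0 < δ × δ < N × (∀ j → 0 < j → j < δ → Is12 (A (at (a + j))))

    next⇒gap : ∀ ξ η a → lastV ξ ≡ at a → Is34 (A (firstV η)) → Next A ξ η →
      Σ ℕ λ δ → firstV η ≡ at (a + δ) × Gap a δ
    next⇒gap ξ η a last≡ first34 (0<δ , empty) = δ , first≡ , 0<δ , δ<N , between12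
      where
      ℓ = pos (lastV ξ)
      last-annular : Annular (lastV ξ)
      last-annular = subst Annular (sym last≡) (at-annular a)
      atℓ≡ata : at ℓ ≡ at a
      atℓ≡ata = trans (sym (at-pos last-annular)) last≡
      posℓ : pos (at ℓ) ≡ ℓ
      posℓ = cong pos (sym (at-pos last-annular))
      δ = cw n ℓ (pos (firstV η))
      δ<N : δ < N
      δ<N = cw<N (pos<N last-annular) (pos<N (is34⇒annular first34))
      first≡ : firstV η ≡ at (a + δ)
      first≡ = trans (subst (λ t → firstV η ≡ at (ℓ + cw n t (pos (firstV η)))) posℓ
                       (at-cw ℓ (is34⇒annular first34)))
                     (at-shiftʳ {ℓ} {a} δ atℓ≡ata)
      between12 : ∀ j → 0 < j → j < δ → Is12 (A (at (a + j)))
      between12 j 0<j j<δ with is12⊎is34 (A (at (a + j)))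
      ... | inj₁ a12 = a12
      ... | inj₂ a34 = ⊥-elim (empty (at (a + j)) a34 (subst (λ t → 0 < t × t < δ) (sym cw≡j) (0<j , j<δ)))
        where
        cw≡j : cw n ℓ (pos (at (a + j))) ≡ j
        cw≡j = trans (cong (cw n ℓ ∘ pos) (at-shiftʳ {a} {ℓ} j (sym atℓ≡ata)))
                 (subst (λ t → cw n t (pos (at (ℓ + j))) ≡ j) posℓ (cw-at ℓ (<-trans j<δ δ<N)))

    gap⇒next : ∀ ξ η a δ → lastV ξ ≡ at a → firstV η ≡ at (a + δ) → Gap a δ → Next A ξ η
    gap⇒next ξ η a δ last≡ first≡ (0<δ , δ<N , between12) = subst (0 <_) (sym cw≡δ) 0<δ , empty
      where
      cw≡δ : cw n (pos (lastV ξ)) (pos (firstV η)) ≡ δ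
      cw≡δ = trans (cong₂ (λ u v → cw n (pos u) (pos v)) last≡ first≡) (cw-at a δ<N)
      empty : ∀ z → Is34 (A z) → ¬ (0 < cw n (pos (lastV ξ)) (pos z) ×
                                   cw n (pos (lastV ξ)) (pos z) < cw n (pos (lastV ξ)) (pos (firstV η)))
      empty z z34 (0<c , c<δ) =
        is12⇒¬is34 (between12 c 0<c (subst (c <_) cw≡δ c<δ)) (subst (Is34 ∘ A) z≡ z34)
        where
        c = cw n (pos (lastV ξ)) (pos z)
        z≡ : z ≡ at (a + c)
        z≡ = trans (at-cw a (is34⇒annular z34)) (cong (λ t → at (a + cw n (pos t) (pos z))) (sym last≡))

    gap≤3 : ∀ {a δ} → Gap a δ → δ ≤ 3
    gap≤3 {a} {δ} (_ , _ , between12) with δ ≤? 3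
    ... | yes δ≤3 = δ≤3
    ... | no δ≰3 = ⊥-elim (is12⇒¬is12-at₂ (1 + a)
          (subst (Is12 ∘ A ∘ at) (+-comm a 1) (between12 1 (s≤s z≤n) (≤-trans (s≤s (s≤s z≤n)) (≰⇒> δ≰3))))
          (subst (Is12 ∘ A ∘ at) (+-comm a 3) (between12 3 (s≤s z≤n) (≰⇒> δ≰3))))

    -- the steps at q → at (1 + q) of the walk are exactly the type-1 edges
    pair12 : ℕ → ℕ
    pair12 q = b2n (isOneTwo (A (at q)) ∧ isOneTwo (A (at (1 + q))))

    count12 : ℕ → ℕ → ℕ
    count12 a zero = 0
    count12 a (suc l) = pair12 a + count12 (suc a) l

    pair12≤1 : ∀ q → pair12 q ≤ 1
    pair12≤1 q with isOneTwo (A (at q)) ∧ isOneTwo (A (at (1 + q)))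
    ... | true = ≤-refl
    ... | false = z≤n

    pair12-34ˡ : ∀ q → Is34 (A (at q)) → pair12 q ≡ 0
    pair12-34ˡ q (inj₁ e) rewrite e = refl
    pair12-34ˡ q (inj₂ e) rewrite e = refl

    pair12-34ʳ : ∀ q → Is34 (A (at (1 + q))) → pair12 q ≡ 0
    pair12-34ʳ q a34 with isOneTwo (A (at q))
    pair12-34ʳ q (inj₁ e) | true rewrite e = refl
    pair12-34ʳ q (inj₂ e) | true rewrite e = refl
    ... | false = refl

    count12-+ : ∀ a x y → count12 a (x + y) ≡ count12 a x + count12 (x + a) y
    count12-+ a zero y = refl
    count12-+ a (suc x) y = begin
      pair12 a + count12 (suc a) (x + y)                       ≡⟨ cong (pair12 a +_) (count12-+ (suc a) x y) ⟩
      pair12 a + (count12 (suc a) x + count12 (x + suc a) y)   ≡⟨ +-assoc (pair12 a) _ _ ⟨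
      count12 a (suc x) + count12 (x + suc a) y                ≡⟨ cong (λ t → count12 a (suc x) + count12 t y) (+-suc x a) ⟩
      count12 a (suc x) + count12 (suc x + a) y                ∎
      where open ≡-Reasoning

    count12-≤ : ∀ a {x y} → x ≤ y → count12 a x ≤ count12 a y
    count12-≤ a {x} {y} x≤y = subst (count12 a x ≤_) (trans (sym (count12-+ a x (y ∸ x))) (cong (count12 a) (m+[n∸m]≡n x≤y)))
                                (m≤m+n _ _)

    count12-suffix : ∀ a x y → count12 (x + a) y ≤ count12 a (x + y)
    count12-suffix a x y = subst (count12 (x + a) y ≤_) (sym (count12-+ a x y)) (m≤n+m _ _)

    count12-periodic : ∀ a → count12 a N ≡ count12 0 N
    count12-periodic zero = refl
    count12-periodic (suc a) = trans (+-cancelˡ-≡ (pair12 a) _ _ shift) (count12-periodic a)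
      where
      open ≡-Reasoning
      shift : pair12 a + count12 (suc a) N ≡ pair12 a + count12 a N
      shift = begin
        count12 a (1 + N)                   ≡⟨ cong (count12 a) (+-comm 1 N) ⟩
        count12 a (N + 1)                   ≡⟨ count12-+ a N 1 ⟩
        count12 a N + (pair12 (N + a) + 0)  ≡⟨ cong (count12 a N +_) (+-identityʳ _) ⟩
        count12 a N + pair12 (N + a)        ≡⟨ cong (λ x → count12 a N + b2n (isOneTwo (A x) ∧ isOneTwo (A (step x)))) (at-N+ a) ⟩
        count12 a N + pair12 a              ≡⟨ +-comm (count12 a N) (pair12 a) ⟩
        pair12 a + count12 a N              ∎

    d≡count12 : d A ≡ count12 0 N
    d≡count12 = trans (cong sum (map-tabulate id f)) (sum-pairs n f 0 pointwise)
      where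
      f : Fin n → ℕ
      f i = b2n (isOneTwo (A (outer i)) ∧ isOneTwo (A (inner i)))
          + b2n (isOneTwo (A (inner i)) ∧ isOneTwo (A (outer (next i))))
      pointwise : ∀ i → f i ≡ pair12 (2 * toℕ i) + pair12 (suc (2 * toℕ i))
      pointwise i = cong₂ _+_
        (cong₂ (λ u v → b2n (isOneTwo (A u) ∧ isOneTwo (A v))) (outer≡at i) (inner≡at i))
        (cong₂ (λ u v → b2n (isOneTwo (A u) ∧ isOneTwo (A v))) (inner≡at i) (cong step (inner≡at i)))
      sum-pairs : ∀ k (h : Fin k → ℕ) a → (∀ i → h i ≡ pair12 (a + 2 * toℕ i) + pair12 (suc (a + 2 * toℕ i))) →
        sum (tabulate h) ≡ count12 a (2 * k)
      sum-pairs zero h a _ = refl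
      sum-pairs (suc k) h a h≡ = begin
        h fzero + sum (tabulate (h ∘ fsuc))                              ≡⟨ cong₂ _+_ (trans (h≡ fzero) head≡) (sum-pairs k (h ∘ fsuc) (2 + a) tail≡) ⟩
        pair12 a + pair12 (suc a) + count12 (2 + a) (2 * k)         ≡⟨ +-assoc (pair12 a) _ _ ⟩
        count12 a (2 + 2 * k)                                        ≡⟨ cong (count12 a) (*-suc 2 k) ⟨
        count12 a (2 * suc k)                                        ∎
        where
        open ≡-Reasoning
        head≡ : pair12 (a + 0) + pair12 (suc (a + 0)) ≡ pair12 a + pair12 (suc a)
        head≡ = cong (λ t → pair12 t + pair12 (suc t)) (+-identityʳ a)
        shift : ∀ t → a + 2 * suc t ≡ 2 + a + 2 * t
        shift t = trans (cong (a +_) (*-suc 2 t)) (trans (+-suc a _) (cong suc (+-suc a _)))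
        tail≡ : ∀ i → h (fsuc i) ≡ pair12 (2 + a + 2 * toℕ i) + pair12 (suc (2 + a + 2 * toℕ i))
        tail≡ i = trans (h≡ (fsuc i)) (cong (λ t → pair12 t + pair12 (suc t)) (shift (toℕ i)))

    d≤count12 : ∀ p a {l} → a + N ≤ l → d A ≤ count12 p l
    d≤count12 p a {l} a+N≤l = begin
      d A                  ≡⟨ d≡count12 ⟩
      count12 0 N          ≡⟨ count12-periodic (a + p) ⟨
      count12 (a + p) N    ≤⟨ count12-suffix p a N ⟩
      count12 p (a + N)    ≤⟨ count12-≤ p a+N≤l ⟩
      count12 p l          ∎
      where open ≤-Reasoning

    -- every position of an arc or its successor lies on the arc, as steps have length ≤ 2
    arc-count12 : ∀ {p L l} → Arc p L l → All34 A L → count12 p (suc l) ≡ 0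
    arc-count12 {p} (arc-end e) all34 = cong (_+ 0) (pair12-34ˡ p (subst (Is34 ∘ A) e (all34 (here refl))))
    arc-count12 {p} (arc-1 e arc) all34 =
      cong₂ _+_ (pair12-34ˡ p (subst (Is34 ∘ A) e (all34 (here refl)))) (arc-count12 arc (all34 ∘ there))
    arc-count12 {p} (arc-2 {xs = _ ∷ _} e arc) all34 =
      cong₂ _+_ (pair12-34ˡ p (subst (Is34 ∘ A) e (all34 (here refl))))
        (cong₂ _+_ (pair12-34ʳ (suc p) (subst (Is34 ∘ A) (arc-firstV arc) (all34 (there (here refl)))))
                   (arc-count12 arc (all34 ∘ there)))

    gap-count12 : ∀ {a δ} → Gap a δ → Is34 (A (at (a + δ))) → count12 (suc a) (δ ∸ 1) ≤ 1
    gap-count12 {a} {1} _ _ = z≤n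
    gap-count12 {a} {2} _ last34 =
      ≤-trans (≤-reflexive (cong (_+ 0) (pair12-34ʳ (suc a) (subst (Is34 ∘ A ∘ at) (+-comm a 2) last34)))) z≤n
    gap-count12 {a} {3} _ last34 = begin
      pair12 (suc a) + (pair12 (2 + a) + 0) ≡⟨ cong (λ t → pair12 (suc a) + (t + 0)) last-pair ⟩
      pair12 (suc a) + 0                   ≡⟨ +-identityʳ _ ⟩
      pair12 (suc a)                       ≤⟨ pair12≤1 (suc a) ⟩
      1                                    ∎
      where
      open ≤-Reasoning
      last-pair : pair12 (2 + a) ≡ 0
      last-pair = pair12-34ʳ (2 + a) (subst (Is34 ∘ A ∘ at) (+-comm a 3) last34)
    gap-count12 {a} {0} (() , _) _
    gap-count12 {a} {suc (suc (suc (suc _)))} gap _ with gap≤3 {a} gap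
    ... | s≤s (s≤s (s≤s ()))

    arc-gap-count12 : ∀ {p L l δ} → Arc p L l → All34 A L → Gap (p + l) δ →
      Is34 (A (at (p + l + δ))) → count12 p (l + δ) ≤ 1
    arc-gap-count12 {p} {L} {l} {δ} arc L-34 gap next-34 = begin
      count12 p (l + δ)                                   ≡⟨ cong (λ t → count12 p (l + t)) (suc-pred δ {{>-nonZero (proj₁ gap)}}) ⟨
      count12 p (l + suc (δ ∸ 1))                         ≡⟨ cong (count12 p) (+-suc l (δ ∸ 1)) ⟩
      count12 p (suc l + (δ ∸ 1))                         ≡⟨ count12-+ p (suc l) (δ ∸ 1) ⟩
      count12 p (suc l) + count12 (suc l + p) (δ ∸ 1)     ≡⟨ cong₂ _+_ (arc-count12 arc L-34) (cong (λ t → count12 (suc t) (δ ∸ 1)) (+-comm l p)) ⟩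
      count12 (suc (p + l)) (δ ∸ 1)                       ≤⟨ gap-count12 {p + l} gap next-34 ⟩
      1                                                   ∎
      where open ≤-Reasoning

    componentPath-arc : ∀ {L p} → ComponentPath A L → firstV L ≡ at p → Σ ℕ (Arc p L)
    componentPath-arc {h ∷ t} c first≡ = linked⇒arc t first≡ (componentPath-linked c)

    -- Walking from ξ i past u more components crosses at most u pairs counted by d.
    module Walk (k : ℕ) (ξ : ℕ → List V) (cons : Consecutive A k ξ)
                (i : ℕ) (1≤i : 1 ≤ i) (p₀ l₀ : ℕ) (arc₀ : Arc p₀ (ξ i) l₀) where

      walk : ∀ u → i + u ≤ k → Σ ℕ λ o → Σ ℕ λ l → Arc (p₀ + o) (ξ (i + u)) l ×
               count12 p₀ o ≤ u × l₀ ≤ o + l × (0 < u → l₀ < o)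
      walk zero _ = 0 , l₀ ,
        subst₂ (λ a b → Arc a (ξ b) l₀) (sym (+-identityʳ p₀)) (sym (+-identityʳ i)) arc₀ ,
        z≤n , ≤-refl , λ ()
      walk (suc u) i+u<k with walk u (≤-trans (+-monoʳ-≤ i (n≤1+n u)) i+u<k)
      ... | o , l , arc , counted , l₀≤o+l , _ =
        o′ , l′ , subst (λ j → Arc (p₀ + o′) (ξ j) l′) (sym (+-suc i u)) arc′ ,
        counted′ , ≤-trans (<⇒≤ l₀<o′) (m≤m+n o′ l′) , (λ _ → l₀<o′)
        where
        j = i + u
        1≤j : 1 ≤ j
        1≤j = ≤-trans 1≤i (m≤m+n i u)
        j<k : j < k
        j<k = subst (_≤ k) (+-suc i u) i+u<k
        comp-j = proj₁ cons j 1≤j (<⇒≤ j<k)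
        comp-j+1 = proj₁ cons (suc j) (s≤s z≤n) j<k
        a = p₀ + o + l
        first-34 = componentPath-all34 comp-j+1 (firstV-∈ comp-j+1)
        gap = next⇒gap (ξ j) (ξ (suc j)) a (arc-lastV arc) first-34 (proj₂ cons j 1≤j j<k)
        δ = proj₁ gap
        0<δ = proj₁ (proj₂ (proj₂ gap))
        o′ = o + l + δ
        first≡ : firstV (ξ (suc j)) ≡ at (p₀ + o′)
        first≡ = trans (proj₁ (proj₂ gap)) (cong at (begin
          p₀ + o + l + δ       ≡⟨ +-assoc (p₀ + o) l δ ⟩
          p₀ + o + (l + δ)     ≡⟨ +-assoc p₀ o (l + δ) ⟩
          p₀ + (o + (l + δ))   ≡⟨ cong (p₀ +_) (+-assoc o l δ) ⟨
          p₀ + o′              ∎))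
          where open ≡-Reasoning
        l′ = proj₁ (componentPath-arc comp-j+1 first≡)
        arc′ = proj₂ (componentPath-arc comp-j+1 first≡)
        l₀<o′ : l₀ < o′
        l₀<o′ = ≤-<-trans l₀≤o+l (m<m+n (o + l) 0<δ)
        counted′ : count12 p₀ o′ ≤ suc u
        counted′ = begin
          count12 p₀ (o + l + δ)                     ≡⟨ cong (count12 p₀) (+-assoc o l δ) ⟩
          count12 p₀ (o + (l + δ))                   ≡⟨ count12-+ p₀ o (l + δ) ⟩
          count12 p₀ o + count12 (o + p₀) (l + δ)    ≡⟨ cong (λ t → count12 p₀ o + count12 t (l + δ)) (+-comm o p₀) ⟩
          count12 p₀ o + count12 (p₀ + o) (l + δ)    ≤⟨ +-mono-≤ counted (arc-gap-count12 arc (componentPath-all34 comp-j)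
                                                          (proj₂ (proj₂ gap)) (subst (Is34 ∘ A) (proj₁ (proj₂ gap)) first-34)) ⟩
          u + 1                                      ≡⟨ +-comm u 1 ⟩
          suc u                                      ∎
          where open ≤-Reasoning

    -- A vertex of ξ i reappearing in ξ (i + u) means the walk went once around the
    -- annulus, crossing all d A = k counted pairs, while it crosses at most u < k.
    consecutive-disjoint : ∀ k ξ → Consecutive A k ξ → d A ≡ k → Disjoint k ξ
    consecutive-disjoint k ξ cons dA≡k i j 1≤i i<j j≤k {y} y∈ξi y∈ξj =
      ¬¬-excluded-middle λ { (yes c<N) → at-distinct (p₀ + a) 0<c c<N same
                           ; (no c≮N) → once-around (≮⇒≥ c≮N) }
      where
      open ≤-Reasoning
      u = j ∸ i
      i+u≡j : i + u ≡ j
      i+u≡j = m+[n∸m]≡n (<⇒≤ i<j)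
      comp-i = proj₁ cons i 1≤i (<⇒≤ (<-≤-trans i<j j≤k))
      p₀ = pos (firstV (ξ i))
      arc₀ = componentPath-arc comp-i (at-pos (is34⇒annular (componentPath-all34 comp-i (firstV-∈ comp-i))))
      l₀ = proj₁ arc₀
      walked = Walk.walk k ξ cons i 1≤i p₀ l₀ (proj₂ arc₀) u (subst (_≤ k) (sym i+u≡j) j≤k)
      o = proj₁ walked
      l = proj₁ (proj₂ walked)
      arc = proj₁ (proj₂ (proj₂ walked))
      counted = proj₁ (proj₂ (proj₂ (proj₂ walked)))
      l₀<o = proj₂ (proj₂ (proj₂ (proj₂ (proj₂ walked)))) (m<n⇒0<n∸m i<j)
      first-hit = arc-∈ (proj₂ arc₀) y∈ξi
      a = proj₁ first-hit
      second-hit = arc-∈ arc (subst (λ t → y ∈ ξ t) (sym i+u≡j) y∈ξj)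
      b = proj₁ second-hit
      a<o+b : a < o + b
      a<o+b = ≤-trans (s≤s (proj₁ (proj₂ first-hit))) (≤-trans l₀<o (m≤m+n o b))
      c = (o + b) ∸ a
      0<c : 0 < c
      0<c = m<n⇒0<n∸m a<o+b
      same : at (p₀ + a) ≡ at (p₀ + a + c)
      same = trans (sym (proj₂ (proj₂ first-hit))) (trans (proj₂ (proj₂ second-hit)) (cong at (begin-equality
        p₀ + o + b         ≡⟨ +-assoc p₀ o b ⟩
        p₀ + (o + b)       ≡⟨ cong (p₀ +_) (m+[n∸m]≡n (<⇒≤ a<o+b)) ⟨
        p₀ + (a + c)       ≡⟨ +-assoc p₀ a c ⟨
        p₀ + a + c         ∎)))
      once-around : N ≤ c → ⊥
      once-around N≤c = <⇒≱ (<-≤-trans (m<n+m u 1≤i) (≤-trans (≤-reflexive i+u≡j) j≤k)) (begin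
        k                                       ≡⟨ dA≡k ⟨
        d A                                     ≤⟨ d≤count12 p₀ a a+N≤ ⟩
        count12 p₀ (o + suc l)                  ≡⟨ count12-+ p₀ o (suc l) ⟩
        count12 p₀ o + count12 (o + p₀) (suc l) ≡⟨ cong (count12 p₀ o +_) last-arc ⟩
        count12 p₀ o + 0                        ≡⟨ +-identityʳ _ ⟩
        count12 p₀ o                            ≤⟨ counted ⟩
        u                                       ∎)
        where
        a+N≤ : a + N ≤ o + suc l
        a+N≤ = begin
          a + N      ≤⟨ +-monoʳ-≤ a N≤c ⟩
          a + c      ≡⟨ m+[n∸m]≡n (<⇒≤ a<o+b) ⟩
          o + b      ≤⟨ +-monoʳ-≤ o (≤-trans (proj₁ (proj₂ second-hit)) (n≤1+n l)) ⟩
          o + suc l  ∎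
        last-arc : count12 (o + p₀) (suc l) ≡ 0
        last-arc = trans (cong (λ t → count12 t (suc l)) (+-comm o p₀))
                         (arc-count12 arc (componentPath-all34 (proj₁ cons (i + u) (≤-trans 1≤i (m≤m+n i u))
                                                                               (subst (_≤ k) (sym i+u≡j) j≤k))))

    disjoint-components-¬adjacent : ∀ {X Y} → ComponentPath A X → ComponentPath A Y →
      (∀ {y} → y ∈ X → y ∉ Y) → ¬ Adj (lastV X) (firstV Y)
    disjoint-components-¬adjacent cX cY X∩Y adj =
      X∩Y (componentPath-closed cX (lastV-∈ cX)
            (adj , componentPath-all34 cX (lastV-∈ cX) , componentPath-all34 cY (firstV-∈ cY)))
          (firstV-∈ cY)

    -- a gap of one or two steps would make the components adjacent
    next-gap-3 : ∀ {X Y} → ComponentPath A X → ComponentPath A Y → (∀ {y} → y ∈ X → y ∉ Y) →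
      Next A X Y → ∀ p → lastV X ≡ at p →
      Is12 (A (at (1 + p))) × Is12 (A (at (2 + p))) × firstV Y ≡ at (3 + p)
    next-gap-3 {X} {Y} cX cY X∩Y nx p last≡ with next⇒gap X Y p last≡ (componentPath-all34 cY (firstV-∈ cY)) nx
    ... | 1 , first≡ , _ = ⊥-elim (disjoint-components-¬adjacent cX cY X∩Y
          (subst₂ Adj (sym last≡) (sym (trans first≡ (cong at (+-comm p 1)))) (at-adj₁ p)))
    ... | 2 , first≡ , _ = ⊥-elim (disjoint-components-¬adjacent cX cY X∩Y
          (subst₂ Adj (sym last≡) (sym (trans first≡ (cong at (+-comm p 2)))) (at-adj₂ p)))
    ... | 3 , first≡ , (_ , _ , between) =
      subst (Is12 ∘ A ∘ at) (+-comm p 1) (between 1 (s≤s z≤n) (s≤s (s≤s z≤n))) ,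
      subst (Is12 ∘ A ∘ at) (+-comm p 2) (between 2 (s≤s z≤n) ≤-refl) ,
      trans first≡ (cong at (+-comm p 3))
    ... | 0 , _ , (() , _)
    ... | suc (suc (suc (suc _))) , _ , gap with gap≤3 {p} gap
    ...   | s≤s (s≤s (s≤s ()))

    -- both vertices at distance one from x would be coloured 1 or 2
    ¬singleton-component : ∀ {x} → ¬ ComponentPath A (x ∷ [])
    ¬singleton-component {x} c = is12⇒¬is12-at₂ (1 + q) (alone (adj-sym (at-adj₁ (1 + q)))) (alone (at-adj₁ (2 + q)))
      where
      x-34 = componentPath-all34 c (here refl)
      q = pos x + N ∸ 2
      x≡ : x ≡ at (2 + q)
      x≡ = begin
        x                  ≡⟨ at-pos (is34⇒annular x-34) ⟩
        at (pos x)         ≡⟨ at-N+ (pos x) ⟨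
        at (N + pos x)     ≡⟨ cong at (+-comm N (pos x)) ⟩
        at (pos x + N)     ≡⟨ cong at (m+[n∸m]≡n (≤-trans 1<N (m≤n+m N (pos x)))) ⟨
        at (2 + q)         ∎
        where open ≡-Reasoning
      alone : ∀ {y} → Adj (at (2 + q)) y → Is12 (A y)
      alone {y} x~y with is12⊎is34 (A y)
      ... | inj₁ y-12 = y-12
      ... | inj₂ y-34 with componentPath-closed c (here refl) (subst (λ v → Adj v y) (sym x≡) x~y , x-34 , y-34)
      ...   | here refl = ⊥-elim (proper (subst (λ v → Adj v x) (sym x≡) x~y) refl)

    record Layout (ξ : ℕ → List V) : Set where
      field
        q : ℕ
        f : V
        fs : List V
        ξ₁≡ : ξ 1 ≡ (f ∷ fs) ++ at (2 + q) ∷ at (3 + q) ∷ []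
        front-last : lastV (f ∷ fs) ≡ at q
        ξ₂-first : firstV (ξ 2) ≡ at (6 + q)
        at₁-12 : Is12 (A (at (1 + q)))
        at₄-12 : Is12 (A (at (4 + q)))
        at₅-12 : Is12 (A (at (5 + q)))

    -- The last two steps of ξ 1 have lengths 2 and 1: every other choice leaves three
    -- consecutive vertices coloured 3, 4 or two 1,2-vertices at distance 2.
    layout-from-steps : ∀ {k ξ} → 2 ≤ k → Consecutive A k ξ → Disjoint k ξ → ∀ {f fs a b} →
      ξ 1 ≡ (f ∷ fs) ++ a ∷ b ∷ [] → CwStep (lastV (f ∷ fs)) a → CwStep a b → Layout ξ
    layout-from-steps {k} {ξ} 2≤k cons disjoint {f} {fs} {a} {b} ξ₁≡ f→a a→b =
      shape a-steps (proj₂ (cwStep-step a→b))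
      where
      comp₁ = proj₁ cons 1 (s≤s z≤n) (≤-trans (s≤s z≤n) 2≤k)
      ξ₁-34 : ∀ {v} → v ∈ (f ∷ fs) ++ a ∷ b ∷ [] → Is34 (A v)
      ξ₁-34 v∈ = componentPath-all34 comp₁ (subst (_ ∈_) (sym ξ₁≡) v∈)
      last-34 = ξ₁-34 (∈-++⁺ˡ (lastV-∷-∈ f fs))
      a-34 = ξ₁-34 (∈-++⁺ʳ (f ∷ fs) (here refl))
      b-34 = ξ₁-34 (∈-++⁺ʳ (f ∷ fs) (there (here refl)))
      q = pos (lastV (f ∷ fs))
      last≡ : lastV (f ∷ fs) ≡ at q
      last≡ = at-pos (is34⇒annular last-34)
      a-steps : a ≡ at (1 + q) ⊎ a ≡ at (2 + q)
      a-steps with proj₂ (cwStep-step f→a)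
      ... | inj₁ e = inj₁ (trans e (cong step last≡))
      ... | inj₂ e = inj₂ (trans e (cong (step ∘ step) last≡))
      gap-after : ∀ p → b ≡ at p → Is12 (A (at (1 + p))) × Is12 (A (at (2 + p))) × firstV (ξ 2) ≡ at (3 + p)
      gap-after p b≡ = next-gap-3 comp₁ (proj₁ cons 2 (s≤s z≤n) 2≤k) (disjoint 1 2 (s≤s z≤n) ≤-refl 2≤k)
        (proj₂ cons 1 (s≤s z≤n) 2≤k) p (trans (cong lastV ξ₁≡) (trans (lastV-++-two (f ∷ fs)) b≡))
      two-step-end : ∀ p → a ≡ at p → b ≡ at (2 + p) → ⊥
      two-step-end p a≡ b≡ with is12⊎is34 (A (at (1 + p)))
      ... | inj₁ mid-12 = is12⇒¬is12-at₂ (1 + p) mid-12 (proj₁ (gap-after (2 + p) b≡))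
      ... | inj₂ mid-34 = ¬is34-triple p (subst (Is34 ∘ A) a≡ a-34) mid-34 (subst (Is34 ∘ A) b≡ b-34)
      shape : a ≡ at (1 + q) ⊎ a ≡ at (2 + q) → b ≡ step a ⊎ b ≡ step (step a) → Layout ξ
      shape (inj₁ a≡) (inj₁ e) = ⊥-elim (¬is34-triple q (subst (Is34 ∘ A) last≡ last-34)
        (subst (Is34 ∘ A) a≡ a-34) (subst (Is34 ∘ A) (trans e (cong step a≡)) b-34))
      shape (inj₁ a≡) (inj₂ e) = ⊥-elim (two-step-end (1 + q) a≡ (trans e (cong (step ∘ step) a≡)))
      shape (inj₂ a≡) (inj₂ e) = ⊥-elim (two-step-end (2 + q) a≡ (trans e (cong (step ∘ step) a≡)))
      shape (inj₂ a≡) (inj₁ e) = record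
        { q = q ; f = f ; fs = fs
        ; ξ₁≡ = trans ξ₁≡ (cong₂ (λ u v → (f ∷ fs) ++ u ∷ v ∷ []) a≡ b≡)
        ; front-last = last≡
        ; ξ₂-first = proj₂ (proj₂ gap)
        ; at₁-12 = at₁-12
        ; at₄-12 = proj₁ gap
        ; at₅-12 = proj₁ (proj₂ gap)
        }
        where
        b≡ : b ≡ at (3 + q)
        b≡ = trans e (cong step a≡)
        gap = gap-after (3 + q) b≡
        at₁-12 : Is12 (A (at (1 + q)))
        at₁-12 with is12⊎is34 (A (at (1 + q)))
        ... | inj₁ mid-12 = mid-12
        ... | inj₂ mid-34 = ⊥-elim (¬is34-triple (1 + q) mid-34 (subst (Is34 ∘ A) a≡ a-34) (subst (Is34 ∘ A) b≡ b-34))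

    layout : ∀ {k ξ} → 2 ≤ k → Consecutive A k ξ → Disjoint k ξ →
      ∀ {x y w rest} → ξ 1 ≡ x ∷ y ∷ w ∷ rest → Layout ξ
    layout 2≤k cons disjoint ξ₁≡ with split-last-two (subst (Linked CwStep) ξ₁≡ (componentPath-linked (proj₁ cons 1 (s≤s z≤n) (≤-trans (s≤s z≤n) 2≤k))))
    ... | _ , _ , _ , _ , split≡ , f→a , a→b = layout-from-steps 2≤k cons disjoint (trans ξ₁≡ split≡) f→a a→b

  is34-≟ : ∀ {a b} → Is34 a → Is34 b → Dec (a ≡ b)
  is34-≟ (inj₁ refl) (inj₁ refl) = yes refl
  is34-≟ (inj₁ refl) (inj₂ refl) = no λ ()
  is34-≟ (inj₂ refl) (inj₁ refl) = no λ ()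
  is34-≟ (inj₂ refl) (inj₂ refl) = yes refl

  sameSupport-is12 : ∀ {A B : Colouring n} → SameSupport A B → ∀ {y} → Is12 (A y) → Is12 (B y)
  sameSupport-is12 {B = B} same {y} y-12 with is12⊎is34 (B y)
  ... | inj₁ B-12 = B-12
  ... | inj₂ B-34 = ⊥-elim (is12⇒¬is34 y-12 (proj₂ (same y) B-34))

  record Separation (A : Colouring n) (s r : V) : Set where
    field
      colouring : Colouring n
      proper : Proper colouring
      normal : Normalized colouring
      kempe : KempeEquiv A colouring
      same-support : SameSupport A colouring
      separated : colouring s ≢ colouring r

  -- if s and r share a colour, swapping 3 and 4 on the component of s separates them
  separate : ∀ {A : Colouring n} → Proper A → Normalized A → ∀ {L s r} → ComponentPath A L →
    s ∈ L → r ∉ L → Is34 (A r) → Separation A s r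
  separate {A} proper normal {L} {s} {r} c s∈ r∉ r-34 with is34-≟ (L-34 s∈) r-34
    where L-34 = componentPath-all34 c
  ... | no s≢r = record
    { colouring = A ; proper = proper ; normal = normal ; kempe = ε
    ; same-support = λ _ → id , id ; separated = s≢r }
  ... | yes s≡r = record
    { colouring = A₁
    ; proper = kempeChange⇒proper proper kempe
    ; normal = swapOn-normalized {A = A} {c₃} {c₄} {L} (pole∉ (inj₁ refl)) (pole∉ (inj₂ refl)) normal
    ; kempe = kempe ◅ ε
    ; same-support = same
    ; separated = λ e → swap-34-changes (L-34 s∈)
        (trans (sym (swapOn-∈ {i = c₃} {c₄} {L} {A} s∈)) (trans e (trans (swapOn-∉ {i = c₃} {c₄} {L} {A} r∉) (sym s≡r))))
    }
    where
    open ProperColouring A proper normal using (pole-is12)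
    L-34 = componentPath-all34 c
    A₁ = swapOn c₃ c₄ L A
    kempe : KempeChange A A₁
    kempe = kempeChange-swapOn (L-34 (firstV-∈ c)) (componentPath-chain⊆ c) (componentPath-⊆chain c)
    pole∉ : ∀ {p} → IsPole p → p ∉ L
    pole∉ p p∈ = is12⇒¬is34 (pole-is12 p) (L-34 p∈)
    same : SameSupport A A₁
    same y with y ∈? L
    ... | yes y∈ = (λ _ → swap-inPair c₃ c₄ (L-34 y∈)) , (λ _ → L-34 y∈)
    ... | no _ = id , id

  -- r r′ ends ξ 1 and s starts ξ 2; since A s ≢ A r, the chain of r in A(A z, A r) is {r, z},
  -- and swapping it moves r out of A(3,4) and z into it.
  module KempeStep (A : Colouring n) (proper : Proper A) (normal : Normalized A) (q : ℕ)
    (at₀-34 : Is34 (A (at q))) (at₁-12 : Is12 (A (at (1 + q)))) (r-34 : Is34 (A (at (2 + q))))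
    (r′-34 : Is34 (A (at (3 + q)))) (z-12 : Is12 (A (at (4 + q)))) (at₅-12 : Is12 (A (at (5 + q))))
    (s-34 : Is34 (A (at (6 + q)))) (s≢r : A (at (6 + q)) ≢ A (at (2 + q))) where

    open ProperColouring A proper normal

    r r′ z s : V
    r = at (2 + q)
    r′ = at (3 + q)
    z = at (4 + q)
    s = at (6 + q)

    B : Colouring n
    B = swapOn (A z) (A r) (r ∷ z ∷ []) A

    ¬pair-34 : ∀ {c} → Is34 c → c ≢ A r → ¬ InPair (A z) (A r) c
    ¬pair-34 c-34 _ (inj₁ refl) = is12⇒¬is34 z-12 c-34
    ¬pair-34 _ c≢ (inj₂ e) = c≢ e

    ¬pair-12 : ∀ {c} → Is12 c → c ≢ A z → ¬ InPair (A z) (A r) c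
    ¬pair-12 _ c≢ (inj₁ e) = c≢ e
    ¬pair-12 c-12 _ (inj₂ refl) = is12⇒¬is34 c-12 r-34

    A-z : A z ≡ forced12 r
    A-z = trans (is12-forced (at-annular (4 + q)) z-12) (forced12-at₂ (2 + q))

    at₁≢z : A (at (1 + q)) ≢ A z
    at₁≢z e = forced12-at₁ (1 + q) (sym (trans (sym (is12-forced (at-annular (1 + q)) at₁-12)) (trans e A-z)))

    from-r : ∀ {v} → Neighbour q v → Adj r v → InPair (A z) (A r) (A v) → v ∈ r ∷ z ∷ []
    from-r back₂ _ v-pair = ⊥-elim (¬pair-34 at₀-34 (proper (at-adj₂ q)) v-pair)
    from-r back₁ _ v-pair = ⊥-elim (¬pair-12 at₁-12 at₁≢z v-pair)
    from-r ahead₁ _ v-pair = ⊥-elim (¬pair-34 r′-34 (proper (at-adj₁ (2 + q)) ∘ sym) v-pair)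
    from-r ahead₂ _ _ = there (here refl)
    from-r (pole p) r~p v-pair = ⊥-elim (¬pair-12 (pole-is12 p) (λ e → pole-colour r~p p (trans e A-z)) v-pair)

    from-z : ∀ {v} → Neighbour (2 + q) v → Adj z v → InPair (A z) (A r) (A v) → v ∈ r ∷ z ∷ []
    from-z back₂ _ _ = here refl
    from-z back₁ _ v-pair = ⊥-elim (¬pair-34 r′-34 (proper (at-adj₁ (2 + q)) ∘ sym) v-pair)
    from-z ahead₁ _ v-pair = ⊥-elim (¬pair-12 at₅-12 (proper (at-adj₁ (4 + q)) ∘ sym) v-pair)
    from-z ahead₂ _ v-pair = ⊥-elim (¬pair-34 s-34 s≢r v-pair)
    from-z (pole p) z~p v-pair = ⊥-elim (¬pair-12 (pole-is12 p) (proper z~p ∘ sym) v-pair)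

    chain-closed : ∀ {u v} → u ∈ r ∷ z ∷ [] → KEdge A (A z) (A r) u v → v ∈ r ∷ z ∷ []
    chain-closed (here refl) (r~v , _ , v-pair) = from-r (neighbours q r~v) r~v v-pair
    chain-closed (there (here refl)) (z~v , _ , v-pair) = from-z (neighbours (2 + q) z~v) z~v v-pair

    kempe : KempeChange A B
    kempe = kempeChange-swapOn (inj₂ refl)
      (λ chain → star-preserves (_∈ r ∷ z ∷ []) chain-closed (here refl) (proj₂ chain))
      (λ { (here refl) → inj₂ refl , ε
         ; (there (here refl)) → inj₂ refl , (at-adj₂ (2 + q) , inj₂ refl , inj₁ refl) ◅ ε })

    proper-B : Proper B
    proper-B = kempeChange⇒proper proper kempe

    normal-B : Normalized B
    normal-B = swapOn-normalized {A = A} {A z} {A r} (pole∉ (inj₁ refl)) (pole∉ (inj₂ refl)) normal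
      where
      pole∉ : ∀ {p} → IsPole p → p ∉ r ∷ z ∷ []
      pole∉ p (here refl) = annular-¬pole (at-annular (2 + q)) p
      pole∉ p (there (here refl)) = annular-¬pole (at-annular (4 + q)) p

    B-r : B r ≡ A z
    B-r = trans (swapOn-∈ {i = A z} {A r} {r ∷ z ∷ []} {A} (here refl)) (swap-second (A z) (A r))

    B-z : B z ≡ A r
    B-z = trans (swapOn-∈ {i = A z} {A r} {r ∷ z ∷ []} {A} (there (here refl))) (swap-first (A z) (A r))

    B-elsewhere : ∀ {y} → y ≢ r → y ≢ z → B y ≡ A y
    B-elsewhere y≢r y≢z = swapOn-∉ {i = A z} {A r} {r ∷ z ∷ []} {A} λ { (here e) → y≢r e ; (there (here e)) → y≢z e }

    z-34 : Is34 (B z)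
    z-34 = subst Is34 (sym B-z) r-34

    r-12 : Is12 (B r)
    r-12 = subst Is12 (sym B-r) z-12

    is34-B : ∀ {y} → Is34 (A y) → y ≢ r → Is34 (B y)
    is34-B y-34 y≢r = subst Is34 (sym (B-elsewhere y≢r λ { refl → is12⇒¬is34 z-12 y-34 })) y-34

    is12-B : ∀ {y} → Is12 (A y) → y ≢ z → Is12 (B y)
    is12-B y-12 y≢z = subst Is12 (sym (B-elsewhere (λ { refl → is12⇒¬is34 y-12 r-34 }) y≢z)) y-12

    B-is34 : ∀ {y} → Is34 (B y) → y ≡ z ⊎ (Is34 (A y) × y ≢ r)
    B-is34 {y} y-34 = cases (y ≟V r) (y ≟V z)
      where
      cases : Dec (y ≡ r) → Dec (y ≡ z) → y ≡ z ⊎ (Is34 (A y) × y ≢ r)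
      cases (yes refl) _ = ⊥-elim (is12⇒¬is34 r-12 y-34)
      cases (no _) (yes y≡z) = inj₁ y≡z
      cases (no y≢r) (no y≢z) = inj₂ (subst Is34 (B-elsewhere y≢r y≢z) y-34 , y≢r)

    z-neighbours-34 : ∀ {y} → Adj z y → Is34 (A y) → y ≡ r ⊎ y ≡ r′ ⊎ y ≡ s
    z-neighbours-34 z~y = go (neighbours (2 + q) z~y)
      where
      go : ∀ {y} → Neighbour (2 + q) y → Is34 (A y) → y ≡ r ⊎ y ≡ r′ ⊎ y ≡ s
      go back₂ _ = inj₁ refl
      go back₁ _ = inj₂ (inj₁ refl)
      go ahead₁ y-34 = ⊥-elim (is12⇒¬is34 at₅-12 y-34)
      go ahead₂ _ = inj₂ (inj₂ refl)
      go (pole p) y-34 = ⊥-elim (is12⇒¬is34 (pole-is12 p) y-34)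

    r′-neighbours-34 : ∀ {y} → Adj r′ y → Is34 (A y) → y ≡ r
    r′-neighbours-34 r′~y = go (neighbours (1 + q) r′~y)
      where
      go : ∀ {y} → Neighbour (1 + q) y → Is34 (A y) → y ≡ r
      go back₂ y-34 = ⊥-elim (is12⇒¬is34 at₁-12 y-34)
      go back₁ _ = refl
      go ahead₁ y-34 = ⊥-elim (is12⇒¬is34 z-12 y-34)
      go ahead₂ y-34 = ⊥-elim (is12⇒¬is34 at₅-12 y-34)
      go (pole p) y-34 = ⊥-elim (is12⇒¬is34 (pole-is12 p) y-34)

    B-edge : ∀ {u v} → KEdge B c₃ c₄ u v →
      (KEdge A c₃ c₄ u v × u ≢ r × v ≢ r) ⊎ (u ≡ z × (v ≡ r′ ⊎ v ≡ s)) ⊎ (v ≡ z × (u ≡ r′ ⊎ u ≡ s))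
    B-edge (u~v , u-34 , v-34) with B-is34 u-34 | B-is34 v-34
    ... | inj₂ (Au , u≢r) | inj₂ (Av , v≢r) = inj₁ ((u~v , Au , Av) , u≢r , v≢r)
    ... | inj₁ refl | inj₁ refl = ⊥-elim (proper u~v refl)
    ... | inj₁ refl | inj₂ (Av , v≢r) = inj₂ (inj₁ (refl , [ ⊥-elim ∘ v≢r , id ] (z-neighbours-34 u~v Av)))
    ... | inj₂ (Au , u≢r) | inj₁ refl = inj₂ (inj₂ (refl , [ ⊥-elim ∘ u≢r , id ] (z-neighbours-34 (adj-sym u~v) Au)))

    module Components (3<N : 3 < N) (k : ℕ) (2≤k : 2 ≤ k) (ξ : ℕ → List V)
      (cons : Consecutive A k ξ) (disjoint : Disjoint k ξ) (f : V) (fs : List V)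
      (ξ₁≡ : ξ 1 ≡ (f ∷ fs) ++ r ∷ r′ ∷ []) (front-last : lastV (f ∷ fs) ≡ at q)
      (ξ₂-first : firstV (ξ 2) ≡ s) where

      module B = ProperColouring B proper-B normal-B

      front = f ∷ fs

      σ : ℕ → List V
      σ 1 = front
      σ 2 = r′ ∷ z ∷ ξ 2
      σ i = ξ i

      σ-≥3 : ∀ i → 2 < i → σ i ≡ ξ i
      σ-≥3 (suc (suc (suc i))) _ = refl
      σ-≥3 1 (s≤s ())
      σ-≥3 2 (s≤s (s≤s ()))

      comp : ∀ i → 1 ≤ i → i ≤ k → ComponentPath A (ξ i)
      comp = proj₁ cons

      comp₁ = comp 1 (s≤s z≤n) (≤-trans (s≤s z≤n) 2≤k)
      comp₂ = comp 2 (s≤s z≤n) 2≤k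

      disjoint₁ : ∀ j → 1 < j → j ≤ k → ∀ {y} → y ∈ ξ 1 → y ∉ ξ j
      disjoint₁ j = disjoint 1 j (s≤s z≤n)

      in-ξ₁ : ∀ {y} → y ∈ front ++ r ∷ r′ ∷ [] → y ∈ ξ 1
      in-ξ₁ = subst (_ ∈_) (sym ξ₁≡)

      r∈ξ₁ : r ∈ ξ 1
      r∈ξ₁ = in-ξ₁ (∈-++⁺ʳ front (here refl))

      r′∈ξ₁ : r′ ∈ ξ 1
      r′∈ξ₁ = in-ξ₁ (∈-++⁺ʳ front (there (here refl)))

      front⊆ξ₁ : ∀ {y} → y ∈ front → y ∈ ξ 1
      front⊆ξ₁ = in-ξ₁ ∘ ∈-++⁺ˡ

      s∈ξ₂ : s ∈ ξ 2
      s∈ξ₂ = subst (_∈ ξ 2) ξ₂-first (firstV-∈ comp₂)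

      unique-ξ₁ : Unique (front ++ r ∷ r′ ∷ [])
      unique-ξ₁ = subst Unique ξ₁≡ (componentPath-unique comp₁)

      r∉front : r ∉ front
      r∉front r∈ = unique-++-disjoint front unique-ξ₁ r∈ (here refl)

      r′∉front : r′ ∉ front
      r′∉front r′∈ = unique-++-disjoint front unique-ξ₁ r′∈ (there (here refl))

      ξ-34 : ∀ {i} → 1 ≤ i → i ≤ k → ∀ {y} → y ∈ ξ i → Is34 (A y)
      ξ-34 1≤i i≤k = componentPath-all34 (comp _ 1≤i i≤k)

      z∉ξ : ∀ {i} → 1 ≤ i → i ≤ k → z ∉ ξ i
      z∉ξ 1≤i i≤k z∈ = is12⇒¬is34 z-12 (ξ-34 1≤i i≤k z∈)

      r′≢r : r′ ≢ r
      r′≢r e = proper (at-adj₁ (2 + q)) (cong A (sym e))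

      front-component : ComponentPath B front
      front-component = componentPath-intro fs
        (linked-++⁻ˡ front (subst (Linked CwStep) ξ₁≡ (componentPath-linked comp₁)))
        (unique-++⁻ˡ front unique-ξ₁)
        (λ y∈ → is34-B (componentPath-all34 comp₁ (front⊆ξ₁ y∈)) λ { refl → r∉front y∈ })
        closed
        where
        closed : Closed34 B front
        closed u∈ e with B-edge e
        ... | inj₁ ((u~v , u-34 , v-34) , u≢r , v≢r)
          with ∈-++⁻ front (subst (_ ∈_) ξ₁≡ (componentPath-closed comp₁ (front⊆ξ₁ u∈) (u~v , u-34 , v-34)))
        ...   | inj₁ v∈ = v∈
        ...   | inj₂ (here refl) = ⊥-elim (v≢r refl)
        ...   | inj₂ (there (here refl)) = ⊥-elim (u≢r (r′-neighbours-34 (adj-sym u~v) u-34))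
        closed u∈ e | inj₂ (inj₁ (refl , _)) = ⊥-elim (z∉ξ (s≤s z≤n) (≤-trans (s≤s z≤n) 2≤k) (front⊆ξ₁ u∈))
        closed u∈ e | inj₂ (inj₂ (refl , inj₁ refl)) = ⊥-elim (r′∉front u∈)
        closed u∈ e | inj₂ (inj₂ (refl , inj₂ refl)) = ⊥-elim (disjoint₁ 2 ≤-refl 2≤k (front⊆ξ₁ u∈) s∈ξ₂)

      grown-component : ∀ {L} → ComponentPath A L → firstV L ≡ s → (∀ {y} → y ∈ L → y ∉ ξ 1) →
        ComponentPath B (r′ ∷ z ∷ L)
      grown-component {h ∷ t} c h≡s L∩ξ₁ = componentPath-intro (z ∷ h ∷ t)
        (step-cwStep (at-annular (3 + q)) ∷ subst (CwStep z) (sym h≡s) (step²-cwStep (at-annular (4 + q)))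
          ∷ componentPath-linked c)
        ((All.tabulate λ { (here refl) → r′-34-vs-z ; (there y∈) refl → L∩ξ₁ y∈ r′∈ξ₁ })
          ∷ All.tabulate (λ { y∈ refl → is12⇒¬is34 z-12 (L-34 y∈) }) ∷ componentPath-unique c)
        all34 closed
        where
        L-34 = componentPath-all34 c
        r′-34-vs-z : r′ ≢ z
        r′-34-vs-z e = is12⇒¬is34 z-12 (subst (Is34 ∘ A) e r′-34)
        all34 : All34 B (r′ ∷ z ∷ h ∷ t)
        all34 (here refl) = is34-B r′-34 r′≢r
        all34 (there (here refl)) = z-34
        all34 (there (there y∈)) = is34-B (L-34 y∈) λ { refl → L∩ξ₁ y∈ r∈ξ₁ }
        closed : Closed34 B (r′ ∷ z ∷ h ∷ t)
        closed u∈ e with B-edge e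
        closed (here refl) _ | inj₁ ((u~v , _ , v-34) , _ , v≢r) = ⊥-elim (v≢r (r′-neighbours-34 u~v v-34))
        closed (there (here refl)) _ | inj₁ ((_ , u-34 , _) , _) = ⊥-elim (is12⇒¬is34 z-12 u-34)
        closed (there (there u∈)) _ | inj₁ (e′ , _) = there (there (componentPath-closed c u∈ e′))
        closed _ _ | inj₂ (inj₁ (_ , inj₁ refl)) = here refl
        closed _ _ | inj₂ (inj₁ (_ , inj₂ refl)) = there (there (subst (_∈ h ∷ t) h≡s (here refl)))
        closed _ _ | inj₂ (inj₂ (refl , _)) = there (here refl)

      unchanged-component : ∀ {L} → ComponentPath A L → (∀ {y} → y ∈ L → y ∉ ξ 1) →
        (∀ {y} → y ∈ L → y ∉ ξ 2) → ComponentPath B L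
      unchanged-component {h ∷ t} c L∩ξ₁ L∩ξ₂ = componentPath-intro t
        (componentPath-linked c) (componentPath-unique c)
        (λ y∈ → is34-B (componentPath-all34 c y∈) λ { refl → L∩ξ₁ y∈ r∈ξ₁ })
        closed
        where
        closed : Closed34 B (h ∷ t)
        closed u∈ e with B-edge e
        ... | inj₁ (e′ , _) = componentPath-closed c u∈ e′
        ... | inj₂ (inj₁ (refl , _)) = ⊥-elim (is12⇒¬is34 z-12 (componentPath-all34 c u∈))
        ... | inj₂ (inj₂ (refl , inj₁ refl)) = ⊥-elim (L∩ξ₁ u∈ r′∈ξ₁)
        ... | inj₂ (inj₂ (refl , inj₂ refl)) = ⊥-elim (L∩ξ₂ u∈ s∈ξ₂)

      next-front : Next B front (r′ ∷ z ∷ ξ 2)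
      next-front = B.gap⇒next front (r′ ∷ z ∷ ξ 2) q 3 front-last (cong at (+-comm 3 q)) (s≤s z≤n , 3<N , between)
        where
        between : ∀ j → 0 < j → j < 3 → Is12 (B (at (q + j)))
        between 1 _ _ = subst (Is12 ∘ B ∘ at) (+-comm 1 q) (is12-B at₁-12 (at₁≢z ∘ cong A))
        between 2 _ _ = subst (Is12 ∘ B ∘ at) (+-comm 2 q) r-12
        between (suc (suc (suc _))) _ (s≤s (s≤s (s≤s ())))

      -- z lies one or two steps after r′ and r, so it is inside the gap after X only if X ends there
      next-kept : ∀ {X Y} → ComponentPath A X → ComponentPath A Y → lastV X ≢ r → lastV X ≢ r′ →
        Next A X Y → Next B X Y
      next-kept {X} {Y} cX cY last≢r last≢r′ nx =
        B.gap⇒next X Y a δ last≡ (proj₁ (proj₂ gap)) (0<δ , δ<N , between)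
        where
        a = pos (lastV X)
        last≡ : lastV X ≡ at a
        last≡ = at-pos (is34⇒annular (componentPath-all34 cX (lastV-∈ cX)))
        gap = next⇒gap X Y a last≡ (componentPath-all34 cY (firstV-∈ cY)) nx
        δ = proj₁ gap
        0<δ = proj₁ (proj₂ (proj₂ gap))
        δ<N = proj₁ (proj₂ (proj₂ (proj₂ gap)))
        not-z : ∀ j → 0 < j → j < 3 → at (a + j) ≢ z
        not-z 1 _ _ e = last≢r′ (trans last≡ (at-cancelˡ {a} {3 + q} 1 (trans (cong at (+-comm 1 a)) e)))
        not-z 2 _ _ e = last≢r (trans last≡ (at-cancelˡ {a} {2 + q} 2 (trans (cong at (+-comm 2 a)) e)))
        not-z (suc (suc (suc _))) _ (s≤s (s≤s (s≤s ())))
        between : ∀ j → 0 < j → j < δ → Is12 (B (at (a + j)))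
        between j 0<j j<δ = is12-B (proj₂ (proj₂ (proj₂ (proj₂ gap))) j 0<j j<δ)
                                   (not-z j 0<j (≤-trans j<δ (gap≤3 {a} (proj₂ (proj₂ gap)))))

      next-grown : ∀ {L Y} → ComponentPath A L → Next B L Y → Next B (r′ ∷ z ∷ L) Y
      next-grown {_ ∷ _} _ nx = nx

      next-from : ∀ i → 2 ≤ i → i < k → Next B (ξ i) (ξ (suc i))
      next-from i 2≤i i<k = next-kept cᵢ (comp (suc i) (s≤s z≤n) i<k)
        (λ e → disjoint₁ i 2≤i (<⇒≤ i<k) r∈ξ₁ (subst (_∈ ξ i) e (lastV-∈ cᵢ)))
        (λ e → disjoint₁ i 2≤i (<⇒≤ i<k) r′∈ξ₁ (subst (_∈ ξ i) e (lastV-∈ cᵢ)))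
        (proj₂ cons i (≤-trans (s≤s z≤n) 2≤i) i<k)
        where
        cᵢ = comp i (≤-trans (s≤s z≤n) 2≤i) (<⇒≤ i<k)

      consecutive-σ : Consecutive B k σ
      consecutive-σ = components , nexts
        where
        components : ∀ i → 1 ≤ i → i ≤ k → ComponentPath B (σ i)
        components 1 _ _ = front-component
        components 2 _ _ = grown-component comp₂ ξ₂-first λ y∈₂ y∈₁ → disjoint₁ 2 ≤-refl 2≤k y∈₁ y∈₂
        components i@(suc (suc (suc _))) _ i≤k = unchanged-component (comp i (s≤s z≤n) i≤k)
          (λ y∈ y∈₁ → disjoint₁ i (s≤s (s≤s z≤n)) i≤k y∈₁ y∈)
          (λ y∈ y∈₂ → disjoint 2 i (s≤s z≤n) (s≤s (s≤s (s≤s z≤n))) i≤k y∈₂ y∈)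
        nexts : ∀ i → 1 ≤ i → i < k → Next B (σ i) (σ (suc i))
        nexts 1 _ _ = next-front
        nexts 2 _ 2<k = next-grown {Y = ξ 3} comp₂ (next-from 2 ≤-refl 2<k)
        nexts i@(suc (suc (suc _))) _ i<k = next-from i (s≤s (s≤s z≤n)) i<k

      disjoint-σ : Disjoint k σ
      disjoint-σ 1 2 _ _ _ y∈ (here refl) = r′∉front y∈
      disjoint-σ 1 2 _ _ 2≤k y∈ (there (here refl)) = z∉ξ (s≤s z≤n) (≤-trans (s≤s z≤n) 2≤k) (front⊆ξ₁ y∈)
      disjoint-σ 1 2 _ _ 2≤k y∈ (there (there y∈₂)) = disjoint₁ 2 ≤-refl 2≤k (front⊆ξ₁ y∈) y∈₂
      disjoint-σ 1 j@(suc (suc (suc _))) _ 1<j j≤k y∈ y∈ⱼ = disjoint₁ j 1<j j≤k (front⊆ξ₁ y∈) y∈ⱼ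
      disjoint-σ 2 j@(suc (suc (suc _))) _ _ j≤k (here refl) y∈ⱼ = disjoint₁ j (s≤s (s≤s z≤n)) j≤k r′∈ξ₁ y∈ⱼ
      disjoint-σ 2 j@(suc (suc (suc _))) _ _ j≤k (there (here refl)) y∈ⱼ = z∉ξ (s≤s z≤n) j≤k y∈ⱼ
      disjoint-σ 2 j@(suc (suc (suc _))) 1≤2 2<j j≤k (there (there y∈₂)) y∈ⱼ = disjoint 2 j 1≤2 2<j j≤k y∈₂ y∈ⱼ
      disjoint-σ i@(suc (suc (suc _))) j@(suc (suc (suc _))) = disjoint i j
      disjoint-σ 1 1 _ (s≤s ())
      disjoint-σ 2 1 _ (s≤s ())
      disjoint-σ 2 2 _ (s≤s (s≤s ()))
      disjoint-σ (suc (suc (suc _))) 1 _ (s≤s ())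
      disjoint-σ (suc (suc (suc _))) 2 _ (s≤s (s≤s ()))

  Conclusion : Colouring n → ℕ → (ℕ → List V) → Set
  Conclusion A k ξ = Σ (Colouring n) λ B₁ → Proper B₁ × Normalized B₁ × KempeEquiv A B₁ ×
    Σ (ℕ → List V) λ σ → Consecutive B₁ k σ ×
      length (σ 1) ≡ 2 ×
      length (σ 2) + 2 ≡ length (ξ 1) + length (ξ 2) ×
      (∀ i → 2 < i → i ≤ k → σ i ≡ ξ i) ×
      σ 1 ≡ take 2 (ξ 1)

  take-2-++ : ∀ (L M : List V) → length (take 2 L) ≡ 2 → take 2 (L ++ M) ≡ take 2 L
  take-2-++ (_ ∷ _ ∷ _) _ _ = refl

  record Shortening (A : Colouring n) (k : ℕ) (ξ : ℕ → List V) (front : List V) : Set where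
    field
      colouring : Colouring n
      proper : Proper colouring
      normal : Normalized colouring
      kempe : KempeEquiv A colouring
      σ : ℕ → List V
      consecutive : Consecutive colouring k σ
      disjoint : Disjoint k σ
      σ₁≡ : σ 1 ≡ front
      σ₂-length : length (σ 2) ≡ 2 + length (ξ 2)
      σ-rest : ∀ i → 2 < i → i ≤ k → σ i ≡ ξ i

  shortening : 3 < N → ∀ {A} (proper : Proper A) (normal : Normalized A) → ∀ {k ξ} → 2 ≤ k →
    Consecutive A k ξ → Disjoint k ξ → (lay : ProperColouring.Layout A proper normal ξ) →
    let open ProperColouring.Layout lay in Shortening A k ξ (f ∷ fs)
  shortening 3<N {A} proper normal {k} {ξ} 2≤k cons disjoint lay = record
    { colouring = KS.B ; proper = KS.proper-B ; normal = KS.normal-B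
    ; kempe = Sep.kempe ◅◅ (KS.kempe ◅ ε)
    ; σ = C.σ ; consecutive = C.consecutive-σ ; disjoint = C.disjoint-σ
    ; σ₁≡ = refl ; σ₂-length = refl ; σ-rest = λ i 2<i _ → C.σ-≥3 i 2<i }
    where
    open ProperColouring.Layout lay
    comp₂ = proj₁ cons 2 (s≤s z≤n) 2≤k
    ξ₁-34 = componentPath-all34 (proj₁ cons 1 (s≤s z≤n) (≤-trans (s≤s z≤n) 2≤k))
    in-ξ₁ : ∀ {y} → y ∈ (f ∷ fs) ++ at (2 + q) ∷ at (3 + q) ∷ [] → y ∈ ξ 1
    in-ξ₁ = subst (_ ∈_) (sym ξ₁≡)
    r∈ξ₁ : at (2 + q) ∈ ξ 1
    r∈ξ₁ = in-ξ₁ (∈-++⁺ʳ (f ∷ fs) (here refl))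
    r′∈ξ₁ : at (3 + q) ∈ ξ 1
    r′∈ξ₁ = in-ξ₁ (∈-++⁺ʳ (f ∷ fs) (there (here refl)))
    at₀∈ξ₁ : at q ∈ ξ 1
    at₀∈ξ₁ = in-ξ₁ (∈-++⁺ˡ (subst (_∈ f ∷ fs) front-last (lastV-∷-∈ f fs)))
    s∈ξ₂ : at (6 + q) ∈ ξ 2
    s∈ξ₂ = subst (_∈ ξ 2) ξ₂-first (firstV-∈ comp₂)
    module Sep = Separation (separate proper normal comp₂ s∈ξ₂
                   (disjoint 1 2 (s≤s z≤n) ≤-refl 2≤k r∈ξ₁) (ξ₁-34 r∈ξ₁))
    is34₁ : ∀ {y} → Is34 (A y) → Is34 (Sep.colouring y)
    is34₁ = proj₁ (Sep.same-support _)
    is12₁ : ∀ {y} → Is12 (A y) → Is12 (Sep.colouring y)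
    is12₁ = sameSupport-is12 Sep.same-support
    module KS = KempeStep Sep.colouring Sep.proper Sep.normal q
      (is34₁ (ξ₁-34 at₀∈ξ₁)) (is12₁ at₁-12) (is34₁ (ξ₁-34 r∈ξ₁)) (is34₁ (ξ₁-34 r′∈ξ₁))
      (is12₁ at₄-12) (is12₁ at₅-12) (is34₁ (componentPath-all34 comp₂ s∈ξ₂)) Sep.separated
    module C = KS.Components 3<N k 2≤k ξ (consecutive-transfer Sep.same-support cons) disjoint
                 f fs ξ₁≡ front-last ξ₂-first

  shortening-conclusion : ∀ {A k ξ f fs a b} → ξ 1 ≡ (f ∷ fs) ++ a ∷ b ∷ [] →
    (S : Shortening A k ξ (f ∷ fs)) → let open Shortening S in Conclusion colouring k σ → Conclusion A k ξ
  shortening-conclusion {A} {k} {ξ} {f} {fs} {a} {b} ξ₁≡ S (B₁ , proper₁ , normal₁ , kempe₁ , τ , cons₁ , τ₁-length , τ₂-length , τ-rest , τ₁≡) =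
    B₁ , proper₁ , normal₁ , S.kempe ◅◅ kempe₁ , τ , cons₁ , τ₁-length , τ₂-length′ ,
    (λ i 2<i i≤k → trans (τ-rest i 2<i i≤k) (S.σ-rest i 2<i i≤k)) , τ₁≡′
    where
    module S = Shortening S
    open ≡-Reasoning
    front = f ∷ fs
    τ₂-length′ : length (τ 2) + 2 ≡ length (ξ 1) + length (ξ 2)
    τ₂-length′ = begin
      length (τ 2) + 2                          ≡⟨ τ₂-length ⟩
      length (S.σ 1) + length (S.σ 2)           ≡⟨ cong₂ _+_ (cong length S.σ₁≡) S.σ₂-length ⟩
      length front + (2 + length (ξ 2))         ≡⟨ +-assoc (length front) 2 _ ⟨
      length front + 2 + length (ξ 2)           ≡⟨ cong (_+ length (ξ 2)) (length-++ front) ⟨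
      length (front ++ a ∷ b ∷ []) + length (ξ 2) ≡⟨ cong (λ L → length L + length (ξ 2)) ξ₁≡ ⟨
      length (ξ 1) + length (ξ 2)               ∎
    τ₁≡front : τ 1 ≡ take 2 front
    τ₁≡front = trans τ₁≡ (cong (take 2) S.σ₁≡)
    τ₁≡′ : τ 1 ≡ take 2 (ξ 1)
    τ₁≡′ = begin
      τ 1                                       ≡⟨ τ₁≡front ⟩
      take 2 front                              ≡⟨ take-2-++ front _ (trans (cong length (sym τ₁≡front)) τ₁-length) ⟨
      take 2 (front ++ a ∷ b ∷ [])              ≡⟨ cong (take 2) ξ₁≡ ⟨
      take 2 (ξ 1)                              ∎

  -- induction on the length of ξ 1, which each shortening decreases by two
  shorten : 3 < N → ∀ bound (A : Colouring n) → Proper A → Normalized A → ∀ k → 2 ≤ k →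
    ∀ ξ → Consecutive A k ξ → Disjoint k ξ → ∀ {L} → ξ 1 ≡ L → length L ≤ bound → Conclusion A k ξ
  shorten _ _ A proper normal k 2≤k ξ cons _ {[]} ξ₁-shape _ =
    ⊥-elim (subst (ComponentPath A) ξ₁-shape (proj₁ cons 1 (s≤s z≤n) (≤-trans (s≤s z≤n) 2≤k)))
  shorten _ _ A proper normal k 2≤k ξ cons _ {_ ∷ []} ξ₁-shape _ =
    ⊥-elim (ProperColouring.¬singleton-component A proper normal
              (subst (ComponentPath A) ξ₁-shape (proj₁ cons 1 (s≤s z≤n) (≤-trans (s≤s z≤n) 2≤k))))
  shorten _ _ A proper normal k 2≤k ξ cons _ {_ ∷ _ ∷ []} ξ₁-shape _ =
    A , proper , normal , ε , ξ , cons , cong length ξ₁-shape , lengths ,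
    (λ _ _ _ → refl) , trans ξ₁-shape (cong (take 2) (sym ξ₁-shape))
    where
    lengths : length (ξ 2) + 2 ≡ length (ξ 1) + length (ξ 2)
    lengths = trans (+-comm (length (ξ 2)) 2) (cong (λ L → length L + length (ξ 2)) (sym ξ₁-shape))
  shorten 3<N (suc bound) A proper normal k 2≤k ξ cons disjoint {x ∷ y ∷ w ∷ rest} ξ₁-shape short
    with ProperColouring.layout A proper normal 2≤k cons disjoint ξ₁-shape
  ... | lay = shortening-conclusion ξ₁≡ S
                (shorten 3<N bound S.colouring S.proper S.normal k 2≤k S.σ S.consecutive S.disjoint S.σ₁≡ front-short)
    where
    open ProperColouring.Layout lay
    S = shortening 3<N proper normal 2≤k cons disjoint lay
    module S = Shortening S
    front-short : length (f ∷ fs) ≤ bound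
    front-short = ≤-pred (≤-trans (m<m+n (length (f ∷ fs)) (s≤s z≤n)) (begin
      length (f ∷ fs) + 2                               ≡⟨ length-++ (f ∷ fs) ⟨
      length ((f ∷ fs) ++ at (2 + q) ∷ at (3 + q) ∷ []) ≡⟨ cong length ξ₁≡ ⟨
      length (ξ 1)                                      ≡⟨ cong length ξ₁-shape ⟩
      length (x ∷ y ∷ w ∷ rest)                         ≤⟨ short ⟩
      suc bound                                         ∎))
      where open ≤-Reasoning

corollary1p1 : (n : ℕ) → 5 ≤ n →
    (A : Colouring n) → Proper A → Normalized A →
    (k : ℕ) → d A ≡ k → 1 < k →
    (ξ : ℕ → List (Vtx n)) → Consecutive A k ξ →
    Σ (Colouring n) λ B₁ → Proper B₁ × Normalized B₁ × KempeEquiv A B₁ ×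
      Σ (ℕ → List (Vtx n)) λ σ → Consecutive B₁ k σ ×
        length (σ 1) ≡ 2 ×
        length (σ 2) + 2 ≡ length (ξ 1) + length (ξ 2) ×
        (∀ i → 2 < i → i ≤ k → σ i ≡ ξ i) ×
        σ 1 ≡ take 2 (ξ 1)
corollary1p1 (suc m) 5≤n A proper normal k dA≡k 1<k ξ cons =
  shorten 3<N (length (ξ 1)) A proper normal k 1<k ξ cons disjoint refl ≤-refl
  where
  open Annulus m
  3<N : 3 < N
  3<N = ≤-trans (s≤s (s≤s (s≤s (s≤s z≤n)))) (*-monoʳ-≤ 2 5≤n)
  disjoint : Disjoint k ξ
  disjoint = ProperColouring.consecutive-disjoint A proper normal k ξ cons dA≡k
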